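{- $\mathrm{p\text{ - }FD}_{\mathrm{basic}}(E_1^{\le}aa)\subseteq\mathrm{para\text{ - }AC}^0$.
   Context: A basic graph is a finite undirected graph without self-loops, represented as a structure over $\{\sim\}$ ($\sim$ binary, symmetric, irreflexive). A formula with pattern $E_1^{\le}aa$ is a sentence $\exists^{\le}X\,\forall x\,\forall y\,\chi$ over $\{\sim\}$ with $X$ a unary second-order variable and $\chi$ quantifier-free (with equality). $(\mathcal G,k)\models\exists^{\le}X\,\varphi(X)$ iff there is a vertex set $C$ with $|C|\le k$ and $\mathcal G\models\varphi(C)$. $\mathrm{p\text{ - }FD}_{\mathrm{basic}}(E_1^{\le}aa)$ is the class of parameterized problems $\{(\mathcal G,k)\mid\mathcal G\text{ basic},(\mathcal G,k)\models\psi\}$ (parameter $k$) for such $\psi$. $\mathrm{para\text{ - }AC}^0$: parameterized problems decided by constant-depth unbounded fan-in circuit families of size $f(k)n^{O(1)}$, $f$ computable. -}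

module Defs where

open import Data.Bool using (Bool; true; false; _∧_; _∨_; not; T)
open import Data.Nat using (ℕ; zero; suc; _+_; _*_; _^_; _≤_)
open import Data.Fin using (Fin; zero; suc)
open import Data.Fin.Properties using (_≟_)
open import Data.Fin.Subset using (Subset; ∣_∣)
open import Data.Vec using (lookup)
open import Data.List using (List; []; _∷_)
open import Data.Product using (Σ; _×_; _,_; ∃-syntax)
open import Relation.Nullary.Decidable using (⌊_⌋)
open import Relation.Binary.PropositionalEquality using (_≡_)

Adj : ℕ → Set
Adj n = Fin n → Fin n → Bool

IsBasic : ∀ {n} → Adj n → Set
IsBasic {n} a = (∀ (u v : Fin n) → a u v ≡ a v u) × (∀ (u : Fin n) → a u u ≡ false)

-- Quantifier-free formulas χ(X, x, y) over {∼} with equality and one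
-- unary second-order variable X.  First-order variables: Fin 2
-- (zero = x, suc zero = y).

Var : Set
Var = Fin 2

data QF : Set where
  adjA : Var → Var → QF
  eqA  : Var → Var → QF
  memA : Var → QF
  ⊤F   : QF
  ¬F   : QF → QF
  _∧F_ : QF → QF → QF
  _∨F_ : QF → QF → QF

⟦_⟧ : ∀ {n} → QF → Adj n → Subset n → (Var → Fin n) → Bool
⟦ adjA v w ⟧ a C e = a (e v) (e w)
⟦ eqA v w  ⟧ a C e = ⌊ e v ≟ e w ⌋
⟦ memA v   ⟧ a C e = lookup C (e v)
⟦ ⊤F       ⟧ a C e = true
⟦ ¬F φ     ⟧ a C e = not (⟦ φ ⟧ a C e)
⟦ φ ∧F ψ   ⟧ a C e = ⟦ φ ⟧ a C e ∧ ⟦ ψ ⟧ a C e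
⟦ φ ∨F ψ   ⟧ a C e = ⟦ φ ⟧ a C e ∨ ⟦ ψ ⟧ a C e

env : ∀ {n} → Fin n → Fin n → Var → Fin n
env x y zero       = x
env x y (suc zero) = y

Models : ∀ {n} → Adj n → ℕ → QF → Set
Models {n} a k χ =
  ∃[ C ] (∣ C ∣ ≤ k × (∀ (x y : Fin n) → T (⟦ χ ⟧ a C (env x y))))

-- The parameterized problem p-FD_basic(ψ) for ψ = ∃^≤X ∀x∀y χ, as a
-- predicate on inputs (adjacency matrix, parameter).
InProblem : ∀ {n} → QF → Adj n → ℕ → Set
InProblem χ a k = IsBasic a × Models a k χ

-- Unbounded fan-in Boolean circuits over input set I, of depth ≤ d
-- (tree-shaped).

data Circ (I : Set) : ℕ → Set where
  inp : ∀ {d} → I → Circ I d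
  neg : ∀ {d} → Circ I d → Circ I (suc d)
  and : ∀ {d} → List (Circ I d) → Circ I (suc d)
  or  : ∀ {d} → List (Circ I d) → Circ I (suc d)

mutual
  eval : ∀ {I d} → Circ I d → (I → Bool) → Bool
  eval (inp i) ρ = ρ i
  eval (neg c) ρ = not (eval c ρ)
  eval (and cs) ρ = evalAll cs ρ
  eval (or cs) ρ = evalAny cs ρ

  evalAll : ∀ {I d} → List (Circ I d) → (I → Bool) → Bool
  evalAll [] ρ = true
  evalAll (c ∷ cs) ρ = eval c ρ ∧ evalAll cs ρ

  evalAny : ∀ {I d} → List (Circ I d) → (I → Bool) → Bool
  evalAny [] ρ = false
  evalAny (c ∷ cs) ρ = eval c ρ ∨ evalAny cs ρ

mutual
  size : ∀ {I d} → Circ I d → ℕ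
  size (inp i) = 1
  size (neg c) = suc (size c)
  size (and cs) = suc (sizes cs)
  size (or cs) = suc (sizes cs)

  sizes : ∀ {I d} → List (Circ I d) → ℕ
  sizes [] = 0
  sizes (c ∷ cs) = size c + sizes cs

Input : ℕ → Set
Input n = Fin n × Fin n

uncurryAdj : ∀ {n} → Adj n → Input n → Bool
uncurryAdj a (u , v) = a u v

-- para-AC⁰ (non-uniform): a family C_{n,k} of circuits of constant depth d
-- and size ≤ f(k)·(n+1)^c deciding the problem.

InParaAC0 : (∀ {n} → Adj n → ℕ → Set) → Set
InParaAC0 P =
  Σ ℕ λ d → Σ ℕ λ c → Σ (ℕ → ℕ) λ f →
  Σ ((n k : ℕ) → Circ (Input n) d) λ C →
    (∀ n k → size (C n k) ≤ f k * suc n ^ c) ×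
    (∀ n k (a : Adj n) → (T (eval (C n k) (uncurryAdj a)) → P a k)
                       × (P a k → T (eval (C n k) (uncurryAdj a))))

-- On a basic graph, χ(C, x, y) only depends on whether x = y, x ∼ y, x ∈ C and y ∈ C, so the
-- constraint splits into a condition U on single vertices and a condition R on pairs of distinct vertices.
-- If n > 2k + 1, at least k + 2 vertices lie outside any admissible C; then either ∅ is a solution, or there is
-- none, or (possibly after complementing the graph) every edge must meet C, i.e. C is a vertex cover. A vertex
-- cover of size ≤ k contains every vertex of degree > k, and dropping from C the vertices that are neither of
-- degree > k nor adjacent to a vertex of degree ≤ k keeps it a solution; the remaining vertices form a "kernel"
-- of at most k + k² vertices. If n ≤ 2k + 1, all vertices are candidates. Hence a solution, if there is one, can
-- be found among at most s = 2k + 1 + k² candidates, and these are AC⁰-definable.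
-- A set of ≤ k vertices among ≤ s candidates is guessed by a circuit of size f(k)·poly(n): pick ≤ s² positions
-- of the binary vertex codes on which the candidates have pairwise distinct restrictions, and ≤ k of these
-- restrictions; there are (log n)^(s²) ≤ f(s)·n choices of positions. The same gadget decides "degree ≤ k".
module Submission where

open import Data.Bool using (Bool; true; false; T; T?; not; _∧_; _∨_; if_then_else_)
open import Data.Bool.Properties using (T-≡; T-not-≡; T-∧; T-∨; ⇔→≡; ∧-identityʳ; ∨-identityʳ; not-involutive)
open import Data.Empty using (⊥; ⊥-elim)
open import Data.Fin using (Fin; zero; suc; inject≤; finToFun; funToFin; combine)
open import Data.Fin.Properties using (_≟_; suc-injective; any?; ¬∀⟶∃¬; funToFin-finToFin; inject≤-injective)
open import Data.Fin.Subset using (Subset; ∣_∣; inside; outside; ⁅_⁆; ∁; _∩_)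
  renaming (_∈_ to _∈ₛ_; _∉_ to _∉ₛ_; _⊆_ to _⊆ₛ_; ⊥ to ∅; ⊤ to everything)
open import Data.Fin.Subset.Properties
  using (_∈?_; p⊆q⇒∣p∣≤∣q∣; ∣p∩q∣≤∣p∣; ∣∁p∣≡n∸∣p∣; ∣⊥∣≡0; ∣⊤∣≡n; ∣⁅x⁆∣≡1; ∉⊥; x∈∁p⇒x∉p; x∉⁅y⁆⇒x≢y;
         x∈p∩q⁺; x∈p∩q⁻)
open import Data.List using (List; []; _∷_; _++_; [_]; length; map; filter; concatMap; cartesianProductWith; allFin)
open import Data.List.Properties
  using (≡-dec; ∷-injective; length-++; length-++-sucʳ; length-map; length-filter; length-tabulate)
open import Data.List.Membership.Propositional using (_∈_)
open import Data.List.Membership.Propositional.Properties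
  using (∈-map⁺; ∈-map⁻; ∈-++⁺ˡ; ∈-++⁺ʳ; ∈-++⁻; ∈-∃++; ∈-concat⁺′; ∈-filter⁺; ∈-filter⁻; ∈-allFin;
         ∈-cartesianProductWith⁺; ∈-cartesianProductWith⁻)
open import Data.List.Membership.DecPropositional (≡-dec {A = Fin 2} _≟_) using () renaming (_∈?_ to _∈ₗ?_)
import Data.List.Relation.Unary.All as All
open import Data.List.Relation.Unary.AllPairs using ([]; _∷_)
open import Data.List.Relation.Unary.Any using (here; there)
open import Data.List.Relation.Unary.Unique.Propositional using (Unique)
import Data.List.Relation.Unary.Unique.Propositional.Properties as Unique
open import Data.Nat using (ℕ; zero; suc; _+_; _*_; _^_; _∸_; _⊔_; _≤_; _<_; _≤?_; _<?_; _/_; _%_; z≤n; s≤s)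
open import Data.Nat.DivMod using (m≡m%n+[m/n]*n; m%n<n)
open import Data.Nat.Properties
  using (*-assoc; *-comm; *-distribʳ-+; *-identityʳ; *-mono-≤; *-monoʳ-≤; *-monoˡ-≤; *-suc; +-identityʳ; +-mono-≤;
         +-monoʳ-≤; +-monoˡ-≤; <⇒≱; ^-*-assoc; ^-distribˡ-+-*; ^-monoʳ-≤; ^-monoˡ-≤; m+n≤o⇒m≤o∸n; m^n>0; m≤m+n;
         m≤n+m; m≤n⇒m≤1+n; n≤1+n; ∸-monoʳ-≤; ≤-<-trans; ≤-pred; ≤-refl; ≤-reflexive; ≤-trans; ≮⇒≥; ≰⇒>;
         m≤m⊔n; m≤n⊔m; ⊔-idem; *-commutativeSemigroup; module ≤-Reasoning)
open import Data.Product using (∃; _×_; _,_; proj₁; proj₂; swap)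
open import Data.Sum as Sum using (_⊎_; inj₁; inj₂)
open import Data.Unit using (⊤; tt)
open import Data.Vec using (lookup; tabulate; []; _∷_; here; there)
open import Data.Vec.Properties
  using ([]=⇒lookup; lookup⇒[]=; lookup∘tabulate; tabulate∘lookup; tabulate-cong; lookup-replicate)
open import Function using (id; _∘_; _⇔_; mk⇔; Equivalence)
open import Relation.Binary.PropositionalEquality
  using (_≡_; _≢_; _≗_; refl; sym; trans; cong; cong₂; subst; subst₂; module ≡-Reasoning)
open import Relation.Nullary using (¬_; yes; no; contradiction; ¬?)
open import Relation.Nullary.Decidable
  using (⌊_⌋; _×-dec_; _⊎-dec_; _→-dec_; toWitness; fromWitness; decidable-stable)
open import Relation.Unary using (Decidable)
open import Algebra.Properties.CommutativeSemigroup *-commutativeSemigroup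
  using () renaming (interchange to *-interchange)

open import Defs

open Equivalence using (to; from)

∈-concatMap⁺′ : ∀ {A B : Set} (f : A → List B) {xs : List A} {x y} → y ∈ f x → x ∈ xs → y ∈ concatMap f xs
∈-concatMap⁺′ f y∈fx x∈xs = ∈-concat⁺′ y∈fx (∈-map⁺ f x∈xs)

length-concatMap-≤ : ∀ {A B : Set} (f : A → List B) {m} (xs : List A) →
                     (∀ {x} → x ∈ xs → length (f x) ≤ m) → length (concatMap f xs) ≤ length xs * m
length-concatMap-≤ f     []       _     = z≤n
length-concatMap-≤ f {m} (x ∷ xs) bound = begin
  length (f x ++ concatMap f xs)          ≡⟨ length-++ (f x) ⟩
  length (f x) + length (concatMap f xs)  ≤⟨ +-mono-≤ (bound (here refl)) (length-concatMap-≤ f xs (bound ∘ there)) ⟩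
  m + length xs * m                       ∎
  where open ≤-Reasoning

length-cartesianProductWith : ∀ {A B C : Set} (f : A → B → C) (xs : List A) (ys : List B) →
                              length (cartesianProductWith f xs ys) ≡ length xs * length ys
length-cartesianProductWith f []       ys = refl
length-cartesianProductWith f (x ∷ xs) ys = begin
  length (map (f x) ys ++ cartesianProductWith f xs ys)
    ≡⟨ length-++ (map (f x) ys) ⟩
  length (map (f x) ys) + length (cartesianProductWith f xs ys)
    ≡⟨ cong₂ _+_ (length-map (f x) ys) (length-cartesianProductWith f xs ys) ⟩
  length ys + length xs * length ys ∎
  where open ≡-Reasoning

injective⇒length≤ : ∀ {A B : Set} (f : A → B) {xs : List A} {ys : List B} → Unique xs →
                    (∀ {x y} → x ∈ xs → y ∈ xs → f x ≡ f y → x ≡ y) → (∀ {x} → x ∈ xs → f x ∈ ys) →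
                    length xs ≤ length ys
injective⇒length≤ f                 []              _   _    = z≤n
injective⇒length≤ f {x ∷ xs} (x∉xs ∷ unique) inj into with ∈-∃++ (into (here refl))
... | us , vs , refl = begin
  suc (length xs)          ≤⟨ s≤s (injective⇒length≤ f unique (λ p q → inj (there p) (there q)) into′) ⟩
  suc (length (us ++ vs))  ≡⟨ length-++-sucʳ us (f x) vs ⟨
  length (us ++ f x ∷ vs)  ∎
  where
  open ≤-Reasoning
  into′ : ∀ {z} → z ∈ xs → f z ∈ us ++ vs
  into′ {z} z∈xs with ∈-++⁻ us (into (there z∈xs))
  ... | inj₁ fz∈us         = ∈-++⁺ˡ fz∈us
  ... | inj₂ (there fz∈vs) = ∈-++⁺ʳ us fz∈vs
  ... | inj₂ (here fz≡fx)  = contradiction (inj (here refl) (there z∈xs) (sym fz≡fx)) (All.lookup x∉xs z∈xs)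

lists≤ : ∀ {A : Set} → List A → ℕ → List (List A)
lists≤ xs zero    = [ [] ]
lists≤ xs (suc m) = [] ∷ cartesianProductWith _∷_ xs (lists≤ xs m)

∈-lists≤ : ∀ {A : Set} {xs : List A} {m} (l : List A) → length l ≤ m → (∀ {z} → z ∈ l → z ∈ xs) →
           l ∈ lists≤ xs m
∈-lists≤ {m = zero}  []      _         _    = here refl
∈-lists≤ {m = suc m} []      _         _    = here refl
∈-lists≤ {m = suc m} (z ∷ l) (s≤s l≤m) l⊆xs =
  there (∈-cartesianProductWith⁺ _∷_ (l⊆xs (here refl)) (∈-lists≤ l l≤m (l⊆xs ∘ there)))

lists≤-length : ∀ {A : Set} (xs : List A) m {l} → l ∈ lists≤ xs m → length l ≤ m
lists≤-length xs zero    (here refl) = z≤n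
lists≤-length xs (suc m) (here refl) = z≤n
lists≤-length xs (suc m) (there l∈)  with ∈-cartesianProductWith⁻ _∷_ xs (lists≤ xs m) l∈
... | _ , l′ , _ , l′∈ , refl = s≤s (lists≤-length xs m l′∈)

length-lists≤ : ∀ {A : Set} (xs : List A) m → length (lists≤ xs m) ≤ suc (length xs) ^ m
length-lists≤ xs zero    = ≤-refl
length-lists≤ xs (suc m) = begin
  suc (length (cartesianProductWith _∷_ xs (lists≤ xs m)))
    ≡⟨ cong suc (length-cartesianProductWith _∷_ xs (lists≤ xs m)) ⟩
  suc (length xs * length (lists≤ xs m))  ≤⟨ s≤s (*-monoʳ-≤ (length xs) (length-lists≤ xs m)) ⟩
  suc (length xs * b)                     ≤⟨ +-monoˡ-≤ (length xs * b) (m^n>0 (suc (length xs)) m) ⟩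
  b + length xs * b                       ∎
  where
  open ≤-Reasoning
  b = suc (length xs) ^ m

elements : ∀ {n} → Subset n → List (Fin n)
elements []            = []
elements (inside  ∷ p) = zero ∷ map suc (elements p)
elements (outside ∷ p) = map suc (elements p)

length-elements : ∀ {n} (p : Subset n) → length (elements p) ≡ ∣ p ∣
length-elements []            = refl
length-elements (inside  ∷ p) = cong suc (trans (length-map suc (elements p)) (length-elements p))
length-elements (outside ∷ p) = trans (length-map suc (elements p)) (length-elements p)

∈-elements⁺ : ∀ {n} {p : Subset n} {x} → x ∈ₛ p → x ∈ elements p
∈-elements⁺ {p = inside  ∷ p} here        = here refl
∈-elements⁺ {p = inside  ∷ p} (there x∈p) = there (∈-map⁺ suc (∈-elements⁺ x∈p))
∈-elements⁺ {p = outside ∷ p} (there x∈p) = ∈-map⁺ suc (∈-elements⁺ x∈p)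

∈-elements⁻ : ∀ {n} (p : Subset n) {x} → x ∈ elements p → x ∈ₛ p
∈-elements⁻ (inside  ∷ p) (here refl) = here
∈-elements⁻ (inside  ∷ p) (there x∈)  with ∈-map⁻ suc x∈
... | y , y∈ , refl = there (∈-elements⁻ p y∈)
∈-elements⁻ (outside ∷ p) x∈          with ∈-map⁻ suc x∈
... | y , y∈ , refl = there (∈-elements⁻ p y∈)

elements-unique : ∀ {n} (p : Subset n) → Unique (elements p)
elements-unique []            = []
elements-unique (inside  ∷ p) = All.tabulate zero∉ ∷ Unique.map⁺ suc-injective (elements-unique p)
  where
  zero∉ : ∀ {y} → y ∈ map suc (elements p) → zero ≢ y
  zero∉ y∈ refl with ∈-map⁻ suc y∈
  ... | _ , _ , ()
elements-unique (outside ∷ p) = Unique.map⁺ suc-injective (elements-unique p)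

injective⇒∣p∣≤length : ∀ {n} {B : Set} (f : Fin n → B) {p : Subset n} {ys : List B} →
                       (∀ {x y} → x ∈ₛ p → y ∈ₛ p → f x ≡ f y → x ≡ y) → (∀ {x} → x ∈ₛ p → f x ∈ ys) →
                       ∣ p ∣ ≤ length ys
injective⇒∣p∣≤length f {p} inj into = subst (_≤ _) (length-elements p)
  (injective⇒length≤ f (elements-unique p) (λ x∈ y∈ → inj (∈-elements⁻ p x∈) (∈-elements⁻ p y∈))
                     (into ∘ ∈-elements⁻ p))

∣q∣<∣p∣⇒∃∈p∉q : ∀ {n} {p q : Subset n} → ∣ q ∣ < ∣ p ∣ → ∃ λ x → x ∈ₛ p × x ∉ₛ q
∣q∣<∣p∣⇒∃∈p∉q {n} {p} {q} q<p with ¬∀⟶∃¬ n (λ x → x ∈ₛ p → x ∈ₛ q) (λ x → x ∈? p →-dec x ∈? q)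
                                          (λ p⊆q → <⇒≱ q<p (p⊆q⇒∣p∣≤∣q∣ (p⊆q _)))
... | x , ¬[x∈p⇒x∈q] with x ∈? p
...   | yes x∈p = x , x∈p , λ x∈q → ¬[x∈p⇒x∈q] (λ _ → x∈q)
...   | no  x∉p = contradiction (λ x∈p → contradiction x∈p x∉p) ¬[x∈p⇒x∈q]

∈ₛ⇔T : ∀ {n} {p : Subset n} {x} → x ∈ₛ p ⇔ T (lookup p x)
∈ₛ⇔T {p = p} {x} = mk⇔ (from T-≡ ∘ []=⇒lookup) (lookup⇒[]= x p ∘ to T-≡)

∈ₛ-tabulate : ∀ {n} {f : Fin n → Bool} {x} → x ∈ₛ tabulate f ⇔ T (f x)
∈ₛ-tabulate {f = f} {x} = mk⇔ (subst T (lookup∘tabulate f x) ∘ to ∈ₛ⇔T)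
                              (from ∈ₛ⇔T ∘ subst T (sym (lookup∘tabulate f x)))

lookup-∈ : ∀ {n} {p : Subset n} {x} → x ∈ₛ p → lookup p x ≡ true
lookup-∈ = to T-≡ ∘ to ∈ₛ⇔T

lookup-∉ : ∀ {n} {p : Subset n} {x} → x ∉ₛ p → lookup p x ≡ false
lookup-∉ {p = p} {x} x∉ with lookup p x in eq
... | true  = contradiction (from ∈ₛ⇔T (subst T (sym eq) _)) x∉
... | false = refl

T-⇔→≡ : ∀ {a b : Bool} → (T a ⇔ T b) → a ≡ b
T-⇔→≡ a⇔b = ⇔→≡ {z = true} (mk⇔ (to T-≡ ∘ to a⇔b ∘ from T-≡) (to T-≡ ∘ from a⇔b ∘ from T-≡))

T-not : ∀ {b} → T (not b) ⇔ (¬ T b)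
T-not {true}  = mk⇔ (λ ()) (λ ¬t → ¬t _)
T-not {false} = mk⇔ (λ _ ()) (λ _ → _)

T-→ : ∀ {a b} → T (not a ∨ b) ⇔ (T a → T b)
T-→ {true}  = mk⇔ (λ t _ → t) (λ f → f _)
T-→ {false} = mk⇔ (λ _ ()) (λ _ → _)

-- Circuits

module _ {I : Set} where

  mutual
    raise : ∀ {d e} → d ≤ e → Circ I d → Circ I e
    raise d≤e       (inp i)  = inp i
    raise (s≤s d≤e) (neg c)  = neg (raise d≤e c)
    raise (s≤s d≤e) (and cs) = and (raiseAll d≤e cs)
    raise (s≤s d≤e) (or cs)  = or (raiseAll d≤e cs)

    raiseAll : ∀ {d e} → d ≤ e → List (Circ I d) → List (Circ I e)
    raiseAll d≤e []       = []
    raiseAll d≤e (c ∷ cs) = raise d≤e c ∷ raiseAll d≤e cs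

  mutual
    eval-raise : ∀ {d e} (d≤e : d ≤ e) (c : Circ I d) ρ → eval (raise d≤e c) ρ ≡ eval c ρ
    eval-raise d≤e       (inp i)  ρ = refl
    eval-raise (s≤s d≤e) (neg c)  ρ = cong not (eval-raise d≤e c ρ)
    eval-raise (s≤s d≤e) (and cs) ρ = evalAll-raise d≤e cs ρ
    eval-raise (s≤s d≤e) (or cs)  ρ = evalAny-raise d≤e cs ρ

    evalAll-raise : ∀ {d e} (d≤e : d ≤ e) (cs : List (Circ I d)) ρ → evalAll (raiseAll d≤e cs) ρ ≡ evalAll cs ρ
    evalAll-raise d≤e []       ρ = refl
    evalAll-raise d≤e (c ∷ cs) ρ = cong₂ _∧_ (eval-raise d≤e c ρ) (evalAll-raise d≤e cs ρ)

    evalAny-raise : ∀ {d e} (d≤e : d ≤ e) (cs : List (Circ I d)) ρ → evalAny (raiseAll d≤e cs) ρ ≡ evalAny cs ρ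
    evalAny-raise d≤e []       ρ = refl
    evalAny-raise d≤e (c ∷ cs) ρ = cong₂ _∨_ (eval-raise d≤e c ρ) (evalAny-raise d≤e cs ρ)

  mutual
    size-raise : ∀ {d e} (d≤e : d ≤ e) (c : Circ I d) → size (raise d≤e c) ≡ size c
    size-raise d≤e       (inp i)  = refl
    size-raise (s≤s d≤e) (neg c)  = cong suc (size-raise d≤e c)
    size-raise (s≤s d≤e) (and cs) = cong suc (sizes-raise d≤e cs)
    size-raise (s≤s d≤e) (or cs)  = cong suc (sizes-raise d≤e cs)

    sizes-raise : ∀ {d e} (d≤e : d ≤ e) (cs : List (Circ I d)) → sizes (raiseAll d≤e cs) ≡ sizes cs
    sizes-raise d≤e []       = refl
    sizes-raise d≤e (c ∷ cs) = cong₂ _+_ (size-raise d≤e c) (sizes-raise d≤e cs)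

  const : ∀ {d} → Bool → Circ I (suc d)
  const true  = and []
  const false = or []

  size-const : ∀ {d} b → size (const {d} b) ≡ 1
  size-const true  = refl
  size-const false = refl

  ⋀ ⋁ : ∀ {A : Set} {d} → List A → (A → Circ I d) → Circ I (suc d)
  ⋀ xs f = and (map f xs)
  ⋁ xs f = or (map f xs)

  _∧ᶜ_ _∨ᶜ_ : ∀ {d e} → Circ I d → Circ I e → Circ I (suc (d ⊔ e))
  _∧ᶜ_ {d} {e} c₁ c₂ = and (raise (m≤m⊔n d e) c₁ ∷ raise (m≤n⊔m d e) c₂ ∷ [])
  _∨ᶜ_ {d} {e} c₁ c₂ = or  (raise (m≤m⊔n d e) c₁ ∷ raise (m≤n⊔m d e) c₂ ∷ [])

  sel : ∀ {d} → Bool → Circ I d → Circ I (suc d)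
  sel b c = or (if b then c ∷ [] else [])

  module _ (ρ : I → Bool) where

    eval-const : ∀ {d} b → eval (const {d} b) ρ ≡ b
    eval-const true  = refl
    eval-const false = refl

    T-⋀ : ∀ {A : Set} {d} (xs : List A) (f : A → Circ I d) →
          T (eval (⋀ xs f) ρ) ⇔ (∀ {x} → x ∈ xs → T (eval (f x) ρ))
    T-⋀ xs f = mk⇔ (elim xs) (intro xs)
      where
      elim : ∀ xs → T (eval (⋀ xs f) ρ) → ∀ {x} → x ∈ xs → T (eval (f x) ρ)
      elim (y ∷ xs) t (here refl) = proj₁ (to T-∧ t)
      elim (y ∷ xs) t (there x∈)  = elim xs (proj₂ (to (T-∧ {eval (f y) ρ}) t)) x∈
      intro : ∀ xs → (∀ {x} → x ∈ xs → T (eval (f x) ρ)) → T (eval (⋀ xs f) ρ)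
      intro []       all = tt
      intro (y ∷ xs) all = from T-∧ (all (here refl) , intro xs (all ∘ there))

    T-⋁ : ∀ {A : Set} {d} (xs : List A) (f : A → Circ I d) →
          T (eval (⋁ xs f) ρ) ⇔ ∃ λ x → x ∈ xs × T (eval (f x) ρ)
    T-⋁ xs f = mk⇔ (elim xs) intro
      where
      elim : ∀ xs → T (eval (⋁ xs f) ρ) → ∃ λ x → x ∈ xs × T (eval (f x) ρ)
      elim (y ∷ xs) t with to (T-∨ {eval (f y) ρ}) t
      ... | inj₁ fy   = y , here refl , fy
      ... | inj₂ rest = let x , x∈ , fx = elim xs rest in x , there x∈ , fx
      intro : ∀ {xs} → (∃ λ x → x ∈ xs × T (eval (f x) ρ)) → T (eval (⋁ xs f) ρ)
      intro         (x , here refl , fx) = from T-∨ (inj₁ fx)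
      intro {y ∷ _} (x , there x∈ , fx)  = from (T-∨ {eval (f y) ρ}) (inj₂ (intro (x , x∈ , fx)))

    eval-∧ᶜ : ∀ {d e} (c₁ : Circ I d) (c₂ : Circ I e) → eval (c₁ ∧ᶜ c₂) ρ ≡ eval c₁ ρ ∧ eval c₂ ρ
    eval-∧ᶜ c₁ c₂ = cong₂ _∧_ (eval-raise _ c₁ ρ) (trans (∧-identityʳ _) (eval-raise _ c₂ ρ))

    eval-∨ᶜ : ∀ {d e} (c₁ : Circ I d) (c₂ : Circ I e) → eval (c₁ ∨ᶜ c₂) ρ ≡ eval c₁ ρ ∨ eval c₂ ρ
    eval-∨ᶜ c₁ c₂ = cong₂ _∨_ (eval-raise _ c₁ ρ) (trans (∨-identityʳ _) (eval-raise _ c₂ ρ))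

    eval-sel : ∀ {d} b (c : Circ I d) → eval (sel b c) ρ ≡ b ∧ eval c ρ
    eval-sel true  c = ∨-identityʳ _
    eval-sel false c = refl

-- Size bounds of the form A · (n + 1) ^ e; ⊗ bounds a gate over a list, ⊕ a binary gate.

Bound : Set
Bound = ℕ × ℕ

_⊗_ _⊕_ : Bound → Bound → Bound
b₁ ⊗ b₂ = suc (proj₁ b₁ * proj₁ b₂) , proj₂ b₁ + proj₂ b₂
b₁ ⊕ b₂ = suc (proj₁ b₁ + proj₁ b₂) , proj₂ b₁ ⊔ proj₂ b₂

1+ : Bound → Bound
1+ b = suc (proj₁ b) , proj₂ b

module Size (n : ℕ) where

  N : ℕ
  N = suc n

  infix 4 _≼_
  record _≼_ (m : ℕ) (b : Bound) : Set where
    constructor mk≼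
    field ≤-bound : m ≤ proj₁ b * N ^ proj₂ b
  open _≼_ public

  N^e>0 : ∀ e → 0 < N ^ e
  N^e>0 = m^n>0 N

  ≼-≤ : ∀ {ℓ m b} → ℓ ≤ m → m ≼ b → ℓ ≼ b
  ≼-≤ ℓ≤m (mk≼ m≤) = mk≼ (≤-trans ℓ≤m m≤)

  ≼-suc : ∀ {m b} → m ≼ b → suc m ≼ 1+ b
  ≼-suc {b = A , e} (mk≼ m≤) = mk≼ (+-mono-≤ (N^e>0 e) m≤)

  ≼-one : ∀ {A e} → 1 ≤ A → 1 ≼ (A , e)
  ≼-one {e = e} A>0 = mk≼ (*-mono-≤ A>0 (N^e>0 e))

  ≼-const : ∀ {m} → m ≼ (m , 0)
  ≼-const {m} = mk≼ (≤-reflexive (sym (*-identityʳ m)))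

  ≼-weaken : ∀ {m A A′ e e′} → A ≤ A′ → e ≤ e′ → m ≼ (A , e) → m ≼ (A′ , e′)
  ≼-weaken A≤A′ e≤e′ (mk≼ m≤) = mk≼ (≤-trans m≤ (*-mono-≤ A≤A′ (^-monoʳ-≤ N e≤e′)))

  ≼-⊗ : ∀ {ℓ m b₁ b₂} → ℓ ≼ b₁ → m ≼ b₂ → suc (ℓ * m) ≼ b₁ ⊗ b₂
  ≼-⊗ {ℓ} {m} {A₁ , e₁} {A₂ , e₂} (mk≼ ℓ≤) (mk≼ m≤) = ≼-suc (mk≼ (begin
    ℓ * m                          ≤⟨ *-mono-≤ ℓ≤ m≤ ⟩
    (A₁ * N ^ e₁) * (A₂ * N ^ e₂)  ≡⟨ *-interchange A₁ (N ^ e₁) A₂ (N ^ e₂) ⟩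
    (A₁ * A₂) * (N ^ e₁ * N ^ e₂)  ≡⟨ cong ((A₁ * A₂) *_) (^-distribˡ-+-* N e₁ e₂) ⟨
    (A₁ * A₂) * N ^ (e₁ + e₂)      ∎))
    where open ≤-Reasoning

  ≼-⊕ : ∀ {ℓ m b₁ b₂} → ℓ ≼ b₁ → m ≼ b₂ → suc (ℓ + m) ≼ b₁ ⊕ b₂
  ≼-⊕ {ℓ} {m} {A₁ , e₁} {A₂ , e₂} ℓ≼ m≼ = ≼-suc (mk≼ (begin
    ℓ + m                                    ≤⟨ +-mono-≤ (≤-bound (≼-weaken {A = A₁} ≤-refl (m≤m⊔n e₁ e₂) ℓ≼))
                                                         (≤-bound (≼-weaken {A = A₂} ≤-refl (m≤n⊔m e₁ e₂) m≼)) ⟩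
    A₁ * N ^ (e₁ ⊔ e₂) + A₂ * N ^ (e₁ ⊔ e₂)  ≡⟨ *-distribʳ-+ (N ^ (e₁ ⊔ e₂)) A₁ A₂ ⟨
    (A₁ + A₂) * N ^ (e₁ ⊔ e₂)                ∎))
    where open ≤-Reasoning

  length-allFin≼ : length (allFin n) ≼ (1 , 1)
  length-allFin≼ = mk≼ (begin
    length (allFin n)  ≡⟨ length-tabulate id ⟩
    n                  ≤⟨ n≤1+n n ⟩
    N                  ≡⟨ trans (+-identityʳ (N * 1)) (*-identityʳ N) ⟨
    1 * N ^ 1          ∎)
    where open ≤-Reasoning

  module _ {I : Set} where

    sizes-map : ∀ {A : Set} {d} (xs : List A) (f : A → Circ I d) {m} →
                (∀ {x} → x ∈ xs → size (f x) ≤ m) → sizes (map f xs) ≤ length xs * m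
    sizes-map []       f bound = z≤n
    sizes-map (x ∷ xs) f bound = +-mono-≤ (bound (here refl)) (sizes-map xs f (bound ∘ there))

    size-gate : ∀ {A : Set} {d} (xs : List A) (f : A → Circ I d) {b₁ b₂} →
                length xs ≼ b₁ → (∀ {x} → x ∈ xs → size (f x) ≼ b₂) → suc (sizes (map f xs)) ≼ b₁ ⊗ b₂
    size-gate xs f {b₁} {A , e} len≼ f≼ = ≼-≤ (s≤s (sizes-map xs f (≤-bound ∘ f≼))) (≼-⊗ len≼ (mk≼ {b = A , e} ≤-refl))

    size-⋀ : ∀ {A : Set} {d} (xs : List A) (f : A → Circ I d) {b₁ b₂} →
             length xs ≼ b₁ → (∀ {x} → x ∈ xs → size (f x) ≼ b₂) → size (⋀ xs f) ≼ b₁ ⊗ b₂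
    size-⋀ = size-gate

    size-⋁ : ∀ {A : Set} {d} (xs : List A) (f : A → Circ I d) {b₁ b₂} →
             length xs ≼ b₁ → (∀ {x} → x ∈ xs → size (f x) ≼ b₂) → size (⋁ xs f) ≼ b₁ ⊗ b₂
    size-⋁ = size-gate

    size-binary : ∀ {d} (c₁ c₂ : Circ I d) {b₁ b₂} → size c₁ ≼ b₁ → size c₂ ≼ b₂ →
                  suc (size c₁ + (size c₂ + 0)) ≼ b₁ ⊕ b₂
    size-binary c₁ c₂ c₁≼ c₂≼ = ≼-≤ (s≤s (+-monoʳ-≤ (size c₁) (≤-reflexive (+-identityʳ (size c₂))))) (≼-⊕ c₁≼ c₂≼)

    size-∧ᶜ : ∀ {d e} (c₁ : Circ I d) (c₂ : Circ I e) {b₁ b₂} → size c₁ ≼ b₁ → size c₂ ≼ b₂ →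
              size (c₁ ∧ᶜ c₂) ≼ b₁ ⊕ b₂
    size-∧ᶜ {d} {e} c₁ c₂ c₁≼ c₂≼ = size-binary (raise (m≤m⊔n d e) c₁) (raise (m≤n⊔m d e) c₂)
      (≼-≤ (≤-reflexive (size-raise _ c₁)) c₁≼) (≼-≤ (≤-reflexive (size-raise _ c₂)) c₂≼)

    size-∨ᶜ : ∀ {d e} (c₁ : Circ I d) (c₂ : Circ I e) {b₁ b₂} → size c₁ ≼ b₁ → size c₂ ≼ b₂ →
              size (c₁ ∨ᶜ c₂) ≼ b₁ ⊕ b₂
    size-∨ᶜ {d} {e} c₁ c₂ c₁≼ c₂≼ = size-binary (raise (m≤m⊔n d e) c₁) (raise (m≤n⊔m d e) c₂)
      (≼-≤ (≤-reflexive (size-raise _ c₁)) c₁≼) (≼-≤ (≤-reflexive (size-raise _ c₂)) c₂≼)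

    size-neg : ∀ {d} (c : Circ I d) {b} → size c ≼ b → size (neg c) ≼ 1+ b
    size-neg c = ≼-suc

    size-sel : ∀ {d} β (c : Circ I d) {b} → size c ≼ b → size (sel β c) ≼ 1+ b
    size-sel true  c c≼ = ≼-suc (≼-≤ (≤-reflexive (+-identityʳ (size c))) c≼)
    size-sel false c c≼ = ≼-suc (≼-≤ z≤n c≼)

-- Hashing vertices by a few bits of their binary codes

bitWidth : ∀ n → ∃ λ w → n ≤ 2 ^ w × 2 ^ w ≤ 2 * suc n
bitWidth zero    = 0 , z≤n , s≤s z≤n
bitWidth (suc n) with bitWidth n
... | w , n≤2^w , 2^w≤2N with suc n ≤? 2 ^ w
...   | yes fits = w , fits , ≤-trans 2^w≤2N (*-monoʳ-≤ 2 (n≤1+n (suc n)))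
...   | no ¬fits = suc w , grows , *-monoʳ-≤ 2 (≤-trans 2^w≤n (≤-trans (n≤1+n n) (n≤1+n (suc n))))
  where
  open ≤-Reasoning
  2^w≤n : 2 ^ w ≤ n
  2^w≤n = ≤-pred (≰⇒> ¬fits)
  grows : suc n ≤ 2 ^ suc w
  grows = begin
    suc n          ≤⟨ s≤s n≤2^w ⟩
    1 + 2 ^ w      ≤⟨ +-monoˡ-≤ (2 ^ w) (m^n>0 2 w) ⟩
    2 ^ w + 2 ^ w  ≡⟨ cong (2 ^ w +_) (+-identityʳ (2 ^ w)) ⟨
    2 ^ suc w      ∎

width : ℕ → ℕ
width n = proj₁ (bitWidth n)

n≤2^width : ∀ n → n ≤ 2 ^ width n
n≤2^width n = proj₁ (proj₂ (bitWidth n))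

2^width≤2N : ∀ n → 2 ^ width n ≤ 2 * suc n
2^width≤2N n = proj₂ (proj₂ (bitWidth n))

bits : ∀ {n} → Fin n → Fin (width n) → Fin 2
bits {n} x = finToFun (inject≤ x (n≤2^width n))

funToFin-cong : ∀ {m k} {f g : Fin m → Fin k} → f ≗ g → funToFin f ≡ funToFin g
funToFin-cong {zero}  f≗g = refl
funToFin-cong {suc m} f≗g = cong₂ combine (f≗g zero) (funToFin-cong (f≗g ∘ suc))

bits-injective : ∀ {n} {x y : Fin n} → bits x ≗ bits y → x ≡ y
bits-injective {n} {x} {y} same = inject≤-injective (n≤2^width n) (n≤2^width n) x y (begin
  inject≤ x (n≤2^width n)  ≡⟨ funToFin-finToFin {width n} {2} (inject≤ x (n≤2^width n)) ⟨
  funToFin (bits x)        ≡⟨ funToFin-cong same ⟩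
  funToFin (bits y)        ≡⟨ funToFin-finToFin {width n} {2} (inject≤ y (n≤2^width n)) ⟩
  inject≤ y (n≤2^width n)  ∎)
  where open ≡-Reasoning

differingBit : ∀ {n} {x y : Fin n} → x ≢ y → ∃ λ j → bits x j ≢ bits y j
differingBit {x = x} {y} x≢y = ¬∀⟶∃¬ _ _ (λ j → bits x j ≟ bits y j) (x≢y ∘ bits-injective)

Label : Set
Label = List (Fin 2)

hash : ∀ {n} → List (Fin (width n)) → Fin n → Label
hash J x = map (bits x) J

length-hash : ∀ {n} (J : List (Fin (width n))) (x : Fin n) → length (hash J x) ≡ length J
length-hash J x = length-map (bits x) J

splitting : ∀ {n} → Fin n → Fin n → List (Fin (width n))
splitting x y with x ≟ y
... | yes _   = []
... | no x≢y = [ proj₁ (differingBit x≢y) ]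

∈-splitting : ∀ {n} {x y : Fin n} → x ≢ y → ∃ λ j → j ∈ splitting x y × bits x j ≢ bits y j
∈-splitting {x = x} {y} x≢y with x ≟ y
... | yes x≡y  = contradiction x≡y x≢y
... | no x≢y′ = proj₁ (differingBit x≢y′) , here refl , proj₂ (differingBit x≢y′)

length-splitting : ∀ {n} (x y : Fin n) → length (splitting x y) ≤ 1
length-splitting x y with x ≟ y
... | yes _ = z≤n
... | no _  = s≤s z≤n

separator : ∀ {n} → List (Fin n) → List (Fin (width n))
separator S = concatMap (λ x → concatMap (splitting x) S) S

length-separator : ∀ {n} (S : List (Fin n)) → length (separator S) ≤ length S * length S
length-separator S = length-concatMap-≤ _ S λ {x} _ →
  ≤-trans (length-concatMap-≤ (splitting x) S (λ {y} _ → length-splitting x y)) (≤-reflexive (*-identityʳ (length S)))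

map≡map⇒≡ : ∀ {A B : Set} {f g : A → B} {xs : List A} {x} → map f xs ≡ map g xs → x ∈ xs → f x ≡ g x
map≡map⇒≡ {xs = _ ∷ _} eq (here refl) = proj₁ (∷-injective eq)
map≡map⇒≡ {xs = _ ∷ _} eq (there x∈)  = map≡map⇒≡ (proj₂ (∷-injective eq)) x∈

hash-separator-injective : ∀ {n} {S : List (Fin n)} {x y} → x ∈ S → y ∈ S →
                           hash (separator S) x ≡ hash (separator S) y → x ≡ y
hash-separator-injective {S = S} {x} {y} x∈S y∈S same with x ≟ y
... | yes x≡y = x≡y
... | no x≢y  = let j , j∈ , differ = ∈-splitting x≢y
                 in contradiction (map≡map⇒≡ same (∈-concatMap⁺′ _ (∈-concatMap⁺′ (splitting x) j∈ y∈S) x∈S)) differ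

1+n≤2^n : ∀ n → suc n ≤ 2 ^ n
1+n≤2^n zero    = s≤s z≤n
1+n≤2^n (suc n) = +-mono-≤ (m^n>0 2 n) (≤-trans (1+n≤2^n n) (≤-reflexive (sym (+-identityʳ (2 ^ n)))))

^-distribʳ-* : ∀ m k t → (m * k) ^ t ≡ m ^ t * k ^ t
^-distribʳ-* m k zero    = refl
^-distribʳ-* m k (suc t) = trans (cong (m * k *_) (^-distribʳ-* m k t)) (*-interchange m k (m ^ t) (k ^ t))

polylog≤exp : ∀ L t → suc L ^ t ≤ suc t ^ t * 2 ^ L
polylog≤exp L t = begin
  suc L ^ t            ≤⟨ ^-monoˡ-≤ t 1+L≤m*[1+q] ⟩
  (m * suc q) ^ t      ≡⟨ ^-distribʳ-* m (suc q) t ⟩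
  m ^ t * suc q ^ t    ≤⟨ *-monoʳ-≤ (m ^ t) (^-monoˡ-≤ t (1+n≤2^n q)) ⟩
  m ^ t * (2 ^ q) ^ t  ≡⟨ cong (m ^ t *_) (^-*-assoc 2 q t) ⟩
  m ^ t * 2 ^ (q * t)  ≤⟨ *-monoʳ-≤ (m ^ t) (^-monoʳ-≤ 2 q*t≤L) ⟩
  m ^ t * 2 ^ L        ∎
  where
  open ≤-Reasoning
  m q r : ℕ
  m = suc t
  q = L / m
  r = L % m
  L≡r+q*m : L ≡ r + q * m
  L≡r+q*m = m≡m%n+[m/n]*n L m
  1+L≤m*[1+q] : suc L ≤ m * suc q
  1+L≤m*[1+q] = begin
    suc L          ≡⟨ cong suc L≡r+q*m ⟩
    suc r + q * m  ≤⟨ +-monoˡ-≤ (q * m) (m%n<n L m) ⟩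
    m + q * m      ≡⟨ cong (m +_) (*-comm q m) ⟩
    m + m * q      ≡⟨ *-suc m q ⟨
    m * suc q      ∎
  q*t≤L : q * t ≤ L
  q*t≤L = begin
    q * t      ≤⟨ *-monoʳ-≤ q (n≤1+n t) ⟩
    q * m      ≤⟨ m≤n+m (q * m) r ⟩
    r + q * m  ≡⟨ L≡r+q*m ⟨
    L          ∎

-- Guessing a small set among few candidates

positionCount : ℕ → ℕ
positionCount s = suc (s * s) ^ (s * s) * 2

labelSetCount : ℕ → ℕ → ℕ
labelSetCount s k = suc (3 ^ (s * s)) ^ k

b-injective : Bound → Bound
b-injective b = (1 , 1) ⊗ ((1 , 1) ⊗ 1+ (1+ b ⊕ 1+ b))

b-guess : ℕ → ℕ → Bound → Bound → Bound
b-guess k s b-cand b-check = (positionCount s , 1) ⊗ ((labelSetCount s k , 0) ⊗ (b-injective b-cand ⊕ b-check))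

-- A pair (J, Λ) of bit positions and labels stands for the set of candidates whose hash under J is listed in Λ.
module Guess {I : Set} {n d e : ℕ} (k s : ℕ) (cand : Fin n → Circ I d)
             (check : (Fin n → Circ I (suc d)) → Circ I e) where

  Positions : Set
  Positions = List (Fin (width n))

  positions : List Positions
  positions = lists≤ (allFin (width n)) (s * s)

  labelSets : List (List Label)
  labelSets = lists≤ (lists≤ (allFin 2) (s * s)) k

  labelled : Positions → List Label → Fin n → Bool
  labelled J Λ x = ⌊ hash J x ∈ₗ? Λ ⌋

  member : Positions → List Label → Fin n → Circ I (suc d)
  member J Λ x = sel (labelled J Λ x) (cand x)

  Collides : Positions → Fin n → Fin n → Set
  Collides J x y = x ≢ y × hash J x ≡ hash J y

  collides? : ∀ J x → Decidable (Collides J x)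
  collides? J x y = ¬? (x ≟ y) ×-dec ≡-dec _≟_ (hash J x) (hash J y)

  collisions : Positions → Fin n → List (Fin n)
  collisions J x = filter (collides? J x) (allFin n)

  disjoint : Positions → List Label → Fin n → Fin n → Circ I (3 + (d ⊔ d))
  disjoint J Λ x y = neg (member J Λ x ∧ᶜ member J Λ y)

  hashInjective : Positions → List Label → Circ I (5 + (d ⊔ d))
  hashInjective J Λ = ⋀ (allFin n) λ x → ⋀ (collisions J x) (disjoint J Λ x)

  body : Positions → List Label → Circ I (suc ((5 + (d ⊔ d)) ⊔ e))
  body J Λ = hashInjective J Λ ∧ᶜ check (member J Λ)

  guess : Circ I (3 + ((5 + (d ⊔ d)) ⊔ e))
  guess = ⋁ positions λ J → ⋁ labelSets (body J)

  module Correctness (ρ : I → Bool) (Good : Subset n → Set)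
                     (check-correct : ∀ M → T (eval (check M) ρ) ⇔ Good (tabulate λ x → eval (M x) ρ)) where

    IsCandidate : Fin n → Set
    IsCandidate x = T (eval (cand x) ρ)

    Member : Positions → List Label → Fin n → Set
    Member J Λ x = T (eval (member J Λ x) ρ)

    T-member : ∀ J Λ x → Member J Λ x ⇔ (hash J x ∈ Λ × IsCandidate x)
    T-member J Λ x = subst (λ β → T β ⇔ (hash J x ∈ Λ × IsCandidate x)) (sym (eval-sel ρ (labelled J Λ x) (cand x)))
      (mk⇔ (λ t → let h , c = to T-∧ t in toWitness h , c) (λ (h , c) → from T-∧ (fromWitness h , c)))

    T-disjoint : ∀ J Λ x y → T (eval (disjoint J Λ x y) ρ) ⇔ (¬ (Member J Λ x × Member J Λ y))
    T-disjoint J Λ x y = subst (λ β → T (not β) ⇔ (¬ (Member J Λ x × Member J Λ y)))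
      (sym (eval-∧ᶜ ρ (member J Λ x) (member J Λ y)))
      (mk⇔ (λ t → to T-not t ∘ from T-∧) (λ ¬both → from T-not (¬both ∘ to T-∧)))

    T-hashInjective : ∀ J Λ → T (eval (hashInjective J Λ) ρ) ⇔
                      (∀ {x y} → Member J Λ x → Member J Λ y → hash J x ≡ hash J y → x ≡ y)
    T-hashInjective J Λ = mk⇔ sound complete
      where
      row : Fin n → Circ I (4 + (d ⊔ d))
      row x = ⋀ (collisions J x) (disjoint J Λ x)
      sound : T (eval (hashInjective J Λ) ρ) →
              ∀ {x y} → Member J Λ x → Member J Λ y → hash J x ≡ hash J y → x ≡ y
      sound t {x} {y} mx my same with x ≟ y
      ... | yes x≡y = x≡y
      ... | no x≢y  = contradiction (mx , my) (to (T-disjoint J Λ x y)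
        (to (T-⋀ ρ (collisions J x) (disjoint J Λ x)) (to (T-⋀ ρ (allFin n) row) t (∈-allFin x))
            (∈-filter⁺ (collides? J x) (∈-allFin y) (x≢y , same))))
      complete : (∀ {x y} → Member J Λ x → Member J Λ y → hash J x ≡ hash J y → x ≡ y) →
                 T (eval (hashInjective J Λ) ρ)
      complete inj = from (T-⋀ ρ (allFin n) row) λ {x} _ → from (T-⋀ ρ (collisions J x) (disjoint J Λ x)) λ {y} y∈ →
        let x≢y , same = proj₂ (∈-filter⁻ (collides? J x) {xs = allFin n} y∈)
        in from (T-disjoint J Λ x y) (λ (mx , my) → x≢y (inj mx my same))

    guess-sound : T (eval guess ρ) → ∃ λ C → ∣ C ∣ ≤ k × (∀ {x} → x ∈ₛ C → IsCandidate x) × Good C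
    guess-sound t with to (T-⋁ ρ positions _) t
    ... | J , _ , t′ with to (T-⋁ ρ labelSets (body J)) t′
    ... | Λ , Λ∈ , t″ with to T-∧ (subst T (eval-∧ᶜ ρ (hashInjective J Λ) (check (member J Λ))) t″)
    ... | injective , good = C , ∣C∣≤k , proj₂ ∘ to (T-member J Λ _) ∘ ∈C⇒member , to (check-correct (member J Λ)) good
      where
      C : Subset n
      C = tabulate λ x → eval (member J Λ x) ρ
      ∈C⇒member : ∀ {x} → x ∈ₛ C → Member J Λ x
      ∈C⇒member = to ∈ₛ-tabulate
      ∣C∣≤k : ∣ C ∣ ≤ k
      ∣C∣≤k = ≤-trans
        (injective⇒∣p∣≤length (hash J)
          (λ x∈ y∈ → to (T-hashInjective J Λ) injective (∈C⇒member x∈) (∈C⇒member y∈))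
          (proj₁ ∘ to (T-member J Λ _) ∘ ∈C⇒member))
        (lists≤-length _ k Λ∈)

    guess-complete : ∀ C → ∣ C ∣ ≤ k → (∀ {x} → x ∈ₛ C → IsCandidate x) → Good C →
                     ∀ S → length S ≤ s → (∀ {x} → IsCandidate x → x ∈ S) → T (eval guess ρ)
    guess-complete C ∣C∣≤k C⊆cand good S |S|≤s cand⊆S =
      from (T-⋁ ρ positions _) (J , J∈ , from (T-⋁ ρ labelSets (body J)) (Λ , Λ∈ , body-holds))
      where
      J : Positions
      J = separator S
      Λ : List Label
      Λ = map (hash J) (elements C)
      |J|≤s*s : length J ≤ s * s
      |J|≤s*s = ≤-trans (length-separator S) (*-mono-≤ |S|≤s |S|≤s)
      J∈ : J ∈ positions
      J∈ = ∈-lists≤ J |J|≤s*s (λ _ → ∈-allFin _)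
      hash∈ : ∀ x → hash J x ∈ lists≤ (allFin 2) (s * s)
      hash∈ x = ∈-lists≤ (hash J x) (≤-trans (≤-reflexive (length-hash J x)) |J|≤s*s) (λ _ → ∈-allFin _)
      Λ∈ : Λ ∈ labelSets
      Λ∈ = ∈-lists≤ Λ (≤-trans (≤-reflexive (trans (length-map (hash J) (elements C)) (length-elements C))) ∣C∣≤k)
        λ l∈ → let x , _ , l≡ = ∈-map⁻ (hash J) l∈ in subst (_∈ _) (sym l≡) (hash∈ x)
      separates : ∀ {x y} → IsCandidate x → IsCandidate y → hash J x ≡ hash J y → x ≡ y
      separates cx cy = hash-separator-injective (cand⊆S cx) (cand⊆S cy)
      member⇔∈C : ∀ x → Member J Λ x ⇔ x ∈ₛ C
      member⇔∈C x = mk⇔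
        (λ m → let h∈ , cx = to (T-member J Λ x) m ; y , y∈ , same = ∈-map⁻ (hash J) h∈ ; y∈C = ∈-elements⁻ C y∈
               in subst (_∈ₛ C) (sym (separates cx (C⊆cand y∈C) same)) y∈C)
        (λ x∈C → from (T-member J Λ x) (∈-map⁺ (hash J) (∈-elements⁺ x∈C) , C⊆cand x∈C))
      members≡C : tabulate (λ x → eval (member J Λ x) ρ) ≡ C
      members≡C = trans
        (tabulate-cong λ x → T-⇔→≡ (mk⇔ (to ∈ₛ⇔T ∘ to (member⇔∈C x)) (from (member⇔∈C x) ∘ from ∈ₛ⇔T)))
        (tabulate∘lookup C)
      injective : T (eval (hashInjective J Λ) ρ)
      injective = from (T-hashInjective J Λ) λ mx my →
        separates (proj₂ (to (T-member J Λ _) mx)) (proj₂ (to (T-member J Λ _) my))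
      body-holds : T (eval (body J Λ) ρ)
      body-holds = subst T (sym (eval-∧ᶜ ρ (hashInjective J Λ) (check (member J Λ))))
        (from T-∧ (injective , from (check-correct (member J Λ)) (subst Good (sym members≡C) good)))

  open Size n

  length-positions : length positions ≼ (positionCount s , 1)
  length-positions = mk≼ (begin
    length positions                     ≤⟨ length-lists≤ (allFin (width n)) t ⟩
    suc (length (allFin (width n))) ^ t  ≡⟨ cong (λ w → suc w ^ t) (length-tabulate id) ⟩
    suc (width n) ^ t                    ≤⟨ polylog≤exp (width n) t ⟩
    suc t ^ t * 2 ^ width n              ≤⟨ *-monoʳ-≤ (suc t ^ t) (2^width≤2N n) ⟩
    suc t ^ t * (2 * N)                  ≡⟨ *-assoc (suc t ^ t) 2 N ⟨
    positionCount s * N                  ≡⟨ cong (positionCount s *_) (*-identityʳ N) ⟨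
    positionCount s * N ^ 1              ∎)
    where
    open ≤-Reasoning
    t : ℕ
    t = s * s

  length-labelSets : length labelSets ≼ (labelSetCount s k , 0)
  length-labelSets =
    ≼-≤ (≤-trans (length-lists≤ _ k) (^-monoˡ-≤ k (s≤s (length-lists≤ (allFin 2) (s * s))))) ≼-const

  module _ (b-cand : Bound) (cand≼ : ∀ x → size (cand x) ≼ b-cand) where

    size-member : ∀ J Λ x → size (member J Λ x) ≼ 1+ b-cand
    size-member J Λ x = size-sel (labelled J Λ x) (cand x) (cand≼ x)

    size-hashInjective : ∀ J Λ → size (hashInjective J Λ) ≼ b-injective b-cand
    size-hashInjective J Λ = size-⋀ (allFin n) _ length-allFin≼ λ {x} _ →
      size-⋀ (collisions J x) _ (≼-≤ (length-filter (collides? J x) (allFin n)) length-allFin≼) λ {y} _ →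
        size-neg (member J Λ x ∧ᶜ member J Λ y)
          (size-∧ᶜ (member J Λ x) (member J Λ y) (size-member J Λ x) (size-member J Λ y))

    size-guess : ∀ b-check → (∀ J Λ → size (check (member J Λ)) ≼ b-check) → size guess ≼ b-guess k s b-cand b-check
    size-guess b-check check≼ = size-⋁ positions _ length-positions λ {J} _ →
      size-⋁ labelSets (body J) length-labelSets λ {Λ} _ →
        size-∧ᶜ (hashInjective J Λ) (check (member J Λ)) (size-hashInjective J Λ) (check≼ J Λ)

b-atMost : ℕ → Bound → Bound
b-atMost m b = b-guess m m b ((1 , 1) ⊗ (1+ b ⊕ 1+ b))

-- ∣ p ∣ ≤ m iff p is covered by a set of at most m vertices, which may be guessed among the vertices of p.
module AtMost {I : Set} {n d : ℕ} (m : ℕ) (p : Fin n → Circ I d) where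

  covers : (Fin n → Circ I (suc d)) → Circ I (3 + (d ⊔ d))
  covers M = ⋀ (allFin n) λ x → neg (p x) ∨ᶜ M x

  open Guess m m p covers

  atMost : Circ I (3 + ((5 + (d ⊔ d)) ⊔ (3 + (d ⊔ d))))
  atMost = guess

  T-atMost : ∀ ρ → T (eval atMost ρ) ⇔ ∣ tabulate (λ x → eval (p x) ρ) ∣ ≤ m
  T-atMost ρ = mk⇔ sound complete
    where
    P : Subset n
    P = tabulate λ x → eval (p x) ρ
    Covers : Subset n → Set
    Covers C = ∀ {x} → T (eval (p x) ρ) → x ∈ₛ C
    T-covers : ∀ M → T (eval (covers M) ρ) ⇔ Covers (tabulate λ x → eval (M x) ρ)
    T-covers M = mk⇔
      (λ t {x} px → from ∈ₛ-tabulate (to (T-row x) (to (T-⋀ ρ (allFin n) row) t (∈-allFin x)) px))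
      (λ covered → from (T-⋀ ρ (allFin n) row) λ {x} _ → from (T-row x) (λ px → to ∈ₛ-tabulate (covered px)))
      where
      row : Fin n → Circ I (suc (suc d ⊔ suc d))
      row x = neg (p x) ∨ᶜ M x
      T-row : ∀ x → T (eval (row x) ρ) ⇔ (T (eval (p x) ρ) → T (eval (M x) ρ))
      T-row x = subst (λ β → T β ⇔ (T (eval (p x) ρ) → T (eval (M x) ρ))) (sym (eval-∨ᶜ ρ (neg (p x)) (M x))) T-→
    open Correctness ρ Covers T-covers
    sound : T (eval atMost ρ) → ∣ P ∣ ≤ m
    sound t = let C , ∣C∣≤m , _ , P⊆C = guess-sound t in ≤-trans (p⊆q⇒∣p∣≤∣q∣ (P⊆C ∘ to ∈ₛ-tabulate)) ∣C∣≤m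
    complete : ∣ P ∣ ≤ m → T (eval atMost ρ)
    complete ∣P∣≤m = guess-complete P ∣P∣≤m (to ∈ₛ-tabulate) (from ∈ₛ-tabulate)
      (elements P) (≤-trans (≤-reflexive (length-elements P)) ∣P∣≤m) (∈-elements⁺ ∘ from ∈ₛ-tabulate)

  module _ (b : Bound) (p≼ : ∀ x → Size._≼_ n (size (p x)) b) where
    open Size n

    size-atMost : size atMost ≼ b-atMost m b
    size-atMost = size-guess b p≼ ((1 , 1) ⊗ (1+ b ⊕ 1+ b)) λ J Λ →
      size-⋀ (allFin n) _ length-allFin≼ λ {x} _ →
        size-∨ᶜ (neg (p x)) (member J Λ x) (size-neg (p x) (p≼ x)) (size-member b p≼ J Λ x)

depth : QF → ℕ → ℕ
depth (¬F φ)   D = suc (depth φ D)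
depth (φ ∧F ψ) D = suc (depth φ D ⊔ depth ψ D)
depth (φ ∨F ψ) D = suc (depth φ D ⊔ depth ψ D)
depth _        D = D

formulaSize : QF → ℕ
formulaSize (¬F φ)   = suc (formulaSize φ)
formulaSize (φ ∧F ψ) = suc (formulaSize φ + formulaSize ψ)
formulaSize (φ ∨F ψ) = suc (formulaSize φ + formulaSize ψ)
formulaSize _        = 1

module _ {n D : ℕ} where

  compile : (φ : QF) → (Fin n → Circ (Input n) (suc D)) → (Var → Fin n) → Circ (Input n) (depth φ (suc D))
  compile (adjA v w) M e = inp (e v , e w)
  compile (eqA v w)  M e = const ⌊ e v ≟ e w ⌋
  compile (memA v)   M e = M (e v)
  compile ⊤F         M e = const true
  compile (¬F φ)     M e = neg (compile φ M e)
  compile (φ ∧F ψ)   M e = compile φ M e ∧ᶜ compile ψ M e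
  compile (φ ∨F ψ)   M e = compile φ M e ∨ᶜ compile ψ M e

  eval-compile : ∀ (φ : QF) M e (a : Adj n) (C : Subset n) → (∀ x → eval (M x) (uncurryAdj a) ≡ lookup C x) →
                 eval (compile φ M e) (uncurryAdj a) ≡ ⟦ φ ⟧ a C e
  eval-compile (adjA v w) M e a C M≡C = refl
  eval-compile (eqA v w)  M e a C M≡C = eval-const _ _
  eval-compile (memA v)   M e a C M≡C = M≡C (e v)
  eval-compile ⊤F         M e a C M≡C = refl
  eval-compile (¬F φ)     M e a C M≡C = cong not (eval-compile φ M e a C M≡C)
  eval-compile (φ ∧F ψ)   M e a C M≡C = trans (eval-∧ᶜ _ (compile φ M e) (compile ψ M e))
    (cong₂ _∧_ (eval-compile φ M e a C M≡C) (eval-compile ψ M e a C M≡C))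
  eval-compile (φ ∨F ψ)   M e a C M≡C = trans (eval-∨ᶜ _ (compile φ M e) (compile ψ M e))
    (cong₂ _∨_ (eval-compile φ M e a C M≡C) (eval-compile ψ M e a C M≡C))

  module _ {A E : ℕ} (A>0 : 1 ≤ A) where
    open Size n

    atom≼ : 1 ≼ (1 * A , E)
    atom≼ = ≼-one (≤-trans A>0 (≤-reflexive (sym (+-identityʳ A))))

    binary-factor : ∀ φ ψ → suc (formulaSize φ * A + formulaSize ψ * A) ≤ suc (formulaSize φ + formulaSize ψ) * A
    binary-factor φ ψ =
      ≤-trans (+-monoˡ-≤ _ A>0) (≤-reflexive (cong (A +_) (sym (*-distribʳ-+ A (formulaSize φ) (formulaSize ψ)))))

    size-compile : ∀ (φ : QF) M e → (∀ x → size (M x) ≼ (A , E)) → size (compile φ M e) ≼ (formulaSize φ * A , E)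
    size-compile (adjA v w) M e M≼ = atom≼
    size-compile (eqA v w)  M e M≼ = ≼-≤ (≤-reflexive (size-const ⌊ e v ≟ e w ⌋)) atom≼
    size-compile (memA v)   M e M≼ = subst (λ A′ → size (M (e v)) ≼ (A′ , E)) (sym (+-identityʳ A)) (M≼ (e v))
    size-compile ⊤F         M e M≼ = atom≼
    size-compile (¬F φ)     M e M≼ =
      ≼-weaken {e = E} (+-monoˡ-≤ _ A>0) ≤-refl (size-neg (compile φ M e) (size-compile φ M e M≼))
    size-compile (φ ∧F ψ)   M e M≼ = ≼-weaken {e′ = E} (binary-factor φ ψ) (≤-reflexive (⊔-idem E))
      (size-∧ᶜ (compile φ M e) (compile ψ M e) (size-compile φ M e M≼) (size-compile ψ M e M≼))
    size-compile (φ ∨F ψ)   M e M≼ = ≼-weaken {e′ = E} (binary-factor φ ψ) (≤-reflexive (⊔-idem E))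
      (size-∨ᶜ (compile φ M e) (compile ψ M e) (size-compile φ M e M≼) (size-compile ψ M e M≼))

Satisfies : ∀ {n} → QF → Adj n → Subset n → Set
Satisfies {n} χ a C = ∀ (x y : Fin n) → T (⟦ χ ⟧ a C (env x y))

-- ⟦ φ ⟧ˡ (x = y) (x ∼ y) (x ∈ X) (y ∈ X): the value of φ at (x, y) on a basic graph.
⟦_⟧ˡ : QF → Bool → Bool → Bool → Bool → Bool
⟦ adjA zero       zero       ⟧ˡ same edge p q = false
⟦ adjA zero       (suc zero) ⟧ˡ same edge p q = edge
⟦ adjA (suc zero) zero       ⟧ˡ same edge p q = edge
⟦ adjA (suc zero) (suc zero) ⟧ˡ same edge p q = false
⟦ eqA  zero       zero       ⟧ˡ same edge p q = true
⟦ eqA  zero       (suc zero) ⟧ˡ same edge p q = same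
⟦ eqA  (suc zero) zero       ⟧ˡ same edge p q = same
⟦ eqA  (suc zero) (suc zero) ⟧ˡ same edge p q = true
⟦ memA zero                  ⟧ˡ same edge p q = p
⟦ memA (suc zero)            ⟧ˡ same edge p q = q
⟦ ⊤F                         ⟧ˡ same edge p q = true
⟦ ¬F φ                       ⟧ˡ same edge p q = not (⟦ φ ⟧ˡ same edge p q)
⟦ φ ∧F ψ                     ⟧ˡ same edge p q = ⟦ φ ⟧ˡ same edge p q ∧ ⟦ ψ ⟧ˡ same edge p q
⟦ φ ∨F ψ                     ⟧ˡ same edge p q = ⟦ φ ⟧ˡ same edge p q ∨ ⟦ ψ ⟧ˡ same edge p q

≟-refl : ∀ {n} (x : Fin n) → ⌊ x ≟ x ⌋ ≡ true
≟-refl x with x ≟ x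
... | yes _   = refl
... | no x≢x = ⊥-elim (x≢x refl)

≟-sym : ∀ {n} (x y : Fin n) → ⌊ y ≟ x ⌋ ≡ ⌊ x ≟ y ⌋
≟-sym x y with x ≟ y | y ≟ x
... | yes _   | yes _   = refl
... | no _    | no _    = refl
... | yes x≡y | no y≢x = ⊥-elim (y≢x (sym x≡y))
... | no x≢y  | yes y≡x = ⊥-elim (x≢y (sym y≡x))

⟦⟧-local : ∀ {n} {a : Adj n} → IsBasic a → ∀ φ C (x y : Fin n) →
           ⟦ φ ⟧ a C (env x y) ≡ ⟦ φ ⟧ˡ ⌊ x ≟ y ⌋ (a x y) (lookup C x) (lookup C y)
⟦⟧-local (symmetric , irreflexive) (adjA zero       zero)       C x y = irreflexive x
⟦⟧-local (symmetric , irreflexive) (adjA zero       (suc zero)) C x y = refl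
⟦⟧-local (symmetric , irreflexive) (adjA (suc zero) zero)       C x y = symmetric y x
⟦⟧-local (symmetric , irreflexive) (adjA (suc zero) (suc zero)) C x y = irreflexive y
⟦⟧-local basic       (eqA  zero       zero)       C x y = ≟-refl x
⟦⟧-local basic       (eqA  zero       (suc zero)) C x y = refl
⟦⟧-local basic       (eqA  (suc zero) zero)       C x y = ≟-sym x y
⟦⟧-local basic       (eqA  (suc zero) (suc zero)) C x y = ≟-refl y
⟦⟧-local basic       (memA zero)                  C x y = refl
⟦⟧-local basic       (memA (suc zero))            C x y = refl
⟦⟧-local basic       ⊤F                           C x y = refl
⟦⟧-local basic       (¬F φ)                       C x y = cong not (⟦⟧-local basic φ C x y)
⟦⟧-local basic       (φ ∧F ψ)                     C x y =
  cong₂ _∧_ (⟦⟧-local basic φ C x y) (⟦⟧-local basic ψ C x y)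
⟦⟧-local basic       (φ ∨F ψ)                     C x y =
  cong₂ _∨_ (⟦⟧-local basic φ C x y) (⟦⟧-local basic ψ C x y)

Solves : ∀ {n} → Adj n → (Bool → Bool) → (Bool → Bool → Bool → Bool) → Subset n → Set
Solves {n} g U R C =
  (∀ x → T (U (lookup C x))) × (∀ (x y : Fin n) → x ≢ y → T (R (g x y) (lookup C x) (lookup C y)))

diagonal : QF → Bool → Bool
diagonal χ p = ⟦ χ ⟧ˡ true false p p

offDiagonal : QF → Bool → Bool → Bool → Bool
offDiagonal χ = ⟦ χ ⟧ˡ false

satisfies⇔solves : ∀ {n} {a : Adj n} → IsBasic a → ∀ χ C →
                   Satisfies χ a C ⇔ Solves a (diagonal χ) (offDiagonal χ) C
satisfies⇔solves {a = a} basic χ C = mk⇔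
  (λ sat → (λ x → subst T (on-diagonal x) (sat x x)) , (λ x y x≢y → subst T (off-diagonal x≢y) (sat x y)))
  (λ (diag , off) x y → satisfied x y diag off)
  where
  on-diagonal : ∀ x → ⟦ χ ⟧ a C (env x x) ≡ diagonal χ (lookup C x)
  on-diagonal x = trans (⟦⟧-local basic χ C x x)
    (cong₂ (λ same edge → ⟦ χ ⟧ˡ same edge (lookup C x) (lookup C x)) (≟-refl x) (proj₂ basic x))
  off-diagonal : ∀ {x y} → x ≢ y → ⟦ χ ⟧ a C (env x y) ≡ offDiagonal χ (a x y) (lookup C x) (lookup C y)
  off-diagonal {x} {y} x≢y with x ≟ y | ⟦⟧-local basic χ C x y
  ... | yes x≡y | _     = ⊥-elim (x≢y x≡y)
  ... | no _    | local = local
  satisfied : ∀ x y → (∀ x → T (diagonal χ (lookup C x))) →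
              (∀ x y → x ≢ y → T (offDiagonal χ (a x y) (lookup C x) (lookup C y))) → T (⟦ χ ⟧ a C (env x y))
  satisfied x y diag off with x ≟ y
  ... | yes refl = subst T (sym (on-diagonal x)) (diag x)
  ... | no x≢y  = subst T (sym (off-diagonal x≢y)) (off x y x≢y)

-- The vertex-cover kernel

neighbours : ∀ {n} → Adj n → Fin n → Subset n
neighbours g v = tabulate (g v)

module Kernel {n} (k : ℕ) (g : Adj n) where

  High : Fin n → Set
  High v = k < ∣ neighbours g v ∣

  high? : Decidable High
  high? v = k <? ∣ neighbours g v ∣

  InKernel : Fin n → Set
  InKernel v = High v ⊎ ∃ λ u → T (g v u) × ¬ High u

  inKernel? : Decidable InKernel
  inKernel? v = high? v ⊎-dec any? (λ u → T? (g v u) ×-dec ¬? (high? u))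

  kernel : Subset n
  kernel = tabulate (λ v → ⌊ inKernel? v ⌋)

  ∈-kernel : ∀ {v} → v ∈ₛ kernel ⇔ InKernel v
  ∈-kernel = mk⇔ (toWitness ∘ to ∈ₛ-tabulate) (from ∈ₛ-tabulate ∘ fromWitness)

  lowNeighbours : Fin n → List (Fin n)
  lowNeighbours u with high? u
  ... | yes _ = []
  ... | no _  = elements (neighbours g u)

  module _ (basic : IsBasic g) {U : Bool → Bool} {R : Bool → Bool → Bool → Bool}
           (U0 : T (U false)) (¬R100 : ¬ T (R true false false)) (R000 : T (R false false false))
           {C : Subset n} (solves : Solves g U R C) (∣C∣≤k : ∣ C ∣ ≤ k) where

    R-at : ∀ {x y e p q} → x ≢ y → g x y ≡ e → lookup C x ≡ p → lookup C y ≡ q → T (R e p q)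
    R-at {x} {y} x≢y refl refl refl = proj₂ solves x y x≢y

    edge-irreflexive : ∀ {x y} → T (g x y) → x ≢ y
    edge-irreflexive {x} gxy refl = subst T (proj₂ basic x) gxy

    covered : ∀ {x y} → T (g x y) → x ∈ₛ C ⊎ y ∈ₛ C
    covered {x} {y} gxy with x ∈? C | y ∈? C
    ... | yes x∈C | _       = inj₁ x∈C
    ... | no _    | yes y∈C = inj₂ y∈C
    ... | no x∉C  | no y∉C  =
      contradiction (R-at (edge-irreflexive gxy) (to T-≡ gxy) (lookup-∉ x∉C) (lookup-∉ y∉C)) ¬R100

    high⊆C : ∀ {v} → High v → v ∈ₛ C
    high⊆C {v} high with v ∈? C
    ... | yes v∈C = v∈C
    ... | no v∉C  = contradiction (≤-trans (p⊆q⇒∣p∣≤∣q∣ neighbours⊆C) ∣C∣≤k) (<⇒≱ high)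
      where
      neighbours⊆C : neighbours g v ⊆ₛ C
      neighbours⊆C u∈ with covered (to ∈ₛ-tabulate u∈)
      ... | inj₁ v∈C = contradiction v∈C v∉C
      ... | inj₂ u∈C = u∈C

    kernel-cover : ∃ λ S → length S ≤ k + k * k × (∀ {v} → InKernel v → v ∈ S)
    kernel-cover = elements C ++ concatMap lowNeighbours (elements C) , length≤ , cover
      where
      open ≤-Reasoning
      length-lowNeighbours : ∀ u → length (lowNeighbours u) ≤ k
      length-lowNeighbours u with high? u
      ... | yes _    = z≤n
      ... | no ¬high = subst (_≤ k) (sym (length-elements (neighbours g u))) (≮⇒≥ ¬high)
      length≤ : length (elements C ++ concatMap lowNeighbours (elements C)) ≤ k + k * k
      length≤ = begin
        length (elements C ++ concatMap lowNeighbours (elements C))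
          ≡⟨ length-++ (elements C) ⟩
        length (elements C) + length (concatMap lowNeighbours (elements C))
          ≤⟨ +-monoʳ-≤ _ (length-concatMap-≤ lowNeighbours (elements C) λ {u} _ → length-lowNeighbours u) ⟩
        length (elements C) + length (elements C) * k
          ≡⟨ cong (λ m → m + m * k) (length-elements C) ⟩
        ∣ C ∣ + ∣ C ∣ * k
          ≤⟨ +-mono-≤ ∣C∣≤k (*-monoˡ-≤ k ∣C∣≤k) ⟩
        k + k * k ∎
      ∈-lowNeighbours : ∀ {u v} → T (g u v) → ¬ High u → v ∈ lowNeighbours u
      ∈-lowNeighbours {u} guv ¬high with high? u
      ... | yes high = contradiction high ¬high
      ... | no _     = ∈-elements⁺ (from ∈ₛ-tabulate guv)
      cover : ∀ {v} → InKernel v → v ∈ elements C ++ concatMap lowNeighbours (elements C)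
      cover (inj₁ high) = ∈-++⁺ˡ (∈-elements⁺ (high⊆C high))
      cover {v} (inj₂ (u , gvu , ¬high)) with covered gvu
      ... | inj₁ v∈C = ∈-++⁺ˡ (∈-elements⁺ v∈C)
      ... | inj₂ u∈C = ∈-++⁺ʳ (elements C)
        (∈-concatMap⁺′ lowNeighbours (∈-lowNeighbours (subst T (proj₁ basic v u) gvu) ¬high) (∈-elements⁺ u∈C))

    inOutPair : ∀ {x y} → x ∈ₛ C → y ∉ₛ C → T (R (g x y) true false) × T (R (g x y) false true)
    inOutPair {x} {y} x∈C y∉C = R-at x≢y refl (lookup-∈ x∈C) (lookup-∉ y∉C)
                          , R-at (x≢y ∘ sym) (proj₁ basic y x) (lookup-∉ y∉C) (lookup-∈ x∈C)
      where
      x≢y : x ≢ y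
      x≢y refl = y∉C x∈C

    inOutEdgeAllowed : ∀ {v} → v ∈ₛ C → High v → T (R true true false) × T (R true false true)
    inOutEdgeAllowed {v} v∈C high =
      let z , z∈ , z∉C = ∣q∣<∣p∣⇒∃∈p∉q {p = neighbours g v} {q = C} (≤-<-trans ∣C∣≤k high)
      in subst (λ e → T (R e true false) × T (R e false true)) (to T-≡ (to ∈ₛ-tabulate z∈)) (inOutPair v∈C z∉C)

    module _ (large : k + k < n) where

      inOutNonEdgeAllowed : ∀ {v} → v ∈ₛ C → ¬ High v → T (R false true false) × T (R false false true)
      inOutNonEdgeAllowed {v} v∈C low =
        let z , z∈∁C , z∉ = ∣q∣<∣p∣⇒∃∈p∉q {p = ∁ C} {q = neighbours g v} deg<∣∁C∣
        in subst (λ e → T (R e true false) × T (R e false true))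
                 (trans (sym (lookup∘tabulate (g v) z)) (lookup-∉ z∉)) (inOutPair v∈C (x∈∁p⇒x∉p z∈∁C))
        where
        open ≤-Reasoning
        deg<∣∁C∣ : ∣ neighbours g v ∣ < ∣ ∁ C ∣
        deg<∣∁C∣ = begin-strict
          ∣ neighbours g v ∣  ≤⟨ ≮⇒≥ low ⟩
          k                   <⟨ m+n≤o⇒m≤o∸n (suc k) large ⟩
          n ∸ k               ≤⟨ ∸-monoʳ-≤ n ∣C∣≤k ⟩
          n ∸ ∣ C ∣           ≡⟨ ∣∁p∣≡n∸∣p∣ C ⟨
          ∣ ∁ C ∣             ∎

      -- The vertices of C outside the kernel have low degree and only high-degree neighbours; dropping them keeps a
      -- solution because those neighbours stay.
      Removed : Fin n → Set
      Removed x = x ∈ₛ C × ¬ InKernel x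

      C′ : Subset n
      C′ = C ∩ kernel

      high⊆C′ : ∀ {y} → High y → y ∈ₛ C′
      high⊆C′ high = x∈p∩q⁺ (high⊆C high , from ∈-kernel (inj₁ high))

      neighbour-high : ∀ {x y} → ¬ InKernel x → T (g x y) → High y
      neighbour-high {y = y} ¬inK gxy = decidable-stable (high? y) λ ¬high → ¬inK (inj₂ (y , gxy , ¬high))

      lookup-C′ : ∀ x → ¬ Removed x → lookup C′ x ≡ lookup C x
      lookup-C′ x kept with x ∈? C′ | x ∈? C
      ... | yes x∈C′ | _       = trans (lookup-∈ x∈C′) (sym (lookup-∈ (proj₁ (x∈p∩q⁻ C kernel x∈C′))))
      ... | no _     | no x∉C  = trans (lookup-∉ (x∉C ∘ proj₁ ∘ x∈p∩q⁻ C kernel)) (sym (lookup-∉ x∉C))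
      ... | no x∉C′  | yes x∈C = contradiction (x∈C , λ inK → x∉C′ (x∈p∩q⁺ (x∈C , from ∈-kernel inK))) kept

      removedPair : ∀ {x y} → Removed x → T (R (g x y) false (lookup C′ y)) × T (R (g x y) (lookup C′ y) false)
      removedPair {x} {y} (x∈C , ¬inK) with g x y in gxy
      ... | true = subst (λ p → T (R true false p) × T (R true p false)) (sym (lookup-∈ (high⊆C′ high)))
                         (swap (inOutEdgeAllowed (high⊆C high) high))
        where
        high : High y
        high = neighbour-high ¬inK (subst T (sym gxy) _)
      ... | false with y ∈? C′
      ...   | yes y∈C′ = subst (λ p → T (R false false p) × T (R false p false)) (sym (lookup-∈ y∈C′))
                               (swap (inOutNonEdgeAllowed x∈C (¬inK ∘ inj₁)))
      ...   | no y∉C′  = subst (λ p → T (R false false p) × T (R false p false)) (sym (lookup-∉ y∉C′))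
                               (R000 , R000)

      removed? : Decidable Removed
      removed? x = x ∈? C ×-dec ¬? (inKernel? x)

      lookup-removed : ∀ {x} → Removed x → lookup C′ x ≡ false
      lookup-removed (_ , ¬inK) = lookup-∉ (¬inK ∘ to ∈-kernel ∘ proj₂ ∘ x∈p∩q⁻ C kernel)

      kernel-solves : Solves g U R C′
      kernel-solves = diagonal-C′ , offDiagonal-C′
        where
        diagonal-C′ : ∀ x → T (U (lookup C′ x))
        diagonal-C′ x with x ∈? C′
        ... | yes x∈C′ =
          subst (T ∘ U) (trans (lookup-∈ (proj₁ (x∈p∩q⁻ C kernel x∈C′))) (sym (lookup-∈ x∈C′))) (proj₁ solves x)
        ... | no x∉C′  = subst (T ∘ U) (sym (lookup-∉ x∉C′)) U0
        offDiagonal-C′ : ∀ x y → x ≢ y → T (R (g x y) (lookup C′ x) (lookup C′ y))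
        offDiagonal-C′ x y x≢y with removed? x | removed? y
        ... | yes rx | _      = subst (λ p → T (R (g x y) p (lookup C′ y))) (sym (lookup-removed rx))
                                      (proj₁ (removedPair rx))
        ... | no _   | yes ry = subst₂ (λ e q → T (R e (lookup C′ x) q)) (proj₁ basic y x) (sym (lookup-removed ry))
                                      (proj₂ (removedPair ry))
        ... | no kx  | no ky  = subst₂ (λ p q → T (R (g x y) p q)) (sym (lookup-C′ x kx)) (sym (lookup-C′ y ky))
                                      (proj₂ solves x y x≢y)

complement : ∀ {n} → Adj n → Adj n
complement g u v = if ⌊ u ≟ v ⌋ then false else not (g u v)

complement-basic : ∀ {n} {g : Adj n} → IsBasic g → IsBasic (complement g)
complement-basic {g = g} (symmetric , _) =
  symmetric′ , λ u → cong (λ b → if b then false else not (g u u)) (≟-refl u)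
  where
  symmetric′ : ∀ u v → complement g u v ≡ complement g v u
  symmetric′ u v with u ≟ v | v ≟ u
  ... | yes _   | yes _   = refl
  ... | no _    | no _    = cong not (symmetric u v)
  ... | yes u≡v | no v≢u = ⊥-elim (v≢u (sym u≡v))
  ... | no u≢v  | yes v≡u = ⊥-elim (u≢v (sym v≡u))

complement-≢ : ∀ {n} (g : Adj n) {u v} → u ≢ v → complement g u v ≡ not (g u v)
complement-≢ g {u} {v} u≢v with u ≟ v
... | yes u≡v = ⊥-elim (u≢v u≡v)
... | no _    = refl

flipEdge : (Bool → Bool → Bool → Bool) → Bool → Bool → Bool → Bool
flipEdge R e = R (not e)

solves-complement : ∀ {n} {g : Adj n} {U R C} → Solves g U R C → Solves (complement g) U (flipEdge R) C
solves-complement {g = g} {R = R} {C} (diag , off) = diag , λ x y x≢y →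
  subst (λ e → T (R e (lookup C x) (lookup C y)))
        (trans (sym (not-involutive (g x y))) (cong not (sym (complement-≢ g x≢y)))) (off x y x≢y)

solves-complement⁻ : ∀ {n} {g : Adj n} {U R C} → Solves (complement g) U (flipEdge R) C → Solves g U R C
solves-complement⁻ {g = g} {R = R} {C} (diag , off) = diag , λ x y x≢y →
  subst (λ e → T (R e (lookup C x) (lookup C y)))
        (trans (cong not (complement-≢ g x≢y)) (not-involutive (g x y))) (off x y x≢y)

data Candidates : Set where
  nobody everybody : Candidates
  kernelOf         : Bool → Candidates

graphFor : ∀ {n} → Bool → Adj n → Adj n
graphFor false g = g
graphFor true  g = complement g

Candidate : ∀ {n} → Candidates → ℕ → Adj n → Fin n → Set
Candidate nobody       k g v = ⊥
Candidate everybody    k g v = ⊤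
Candidate (kernelOf b) k g v = Kernel.InKernel k (graphFor b g) v

-- The arguments are U(0), R(1,0,0) and R(0,0,0), where R(x ∼ y, x ∈ C, y ∈ C) constrains distinct x, y.
-- If R(1,0,0) fails and R(0,0,0) holds, the solutions are the vertex covers satisfying further local conditions;
-- with the two values exchanged, the same holds for the complement graph. In the other cases a large graph has
-- either no solution or the solution ∅.
regime : Bool → Bool → Bool → Candidates
regime true false true  = kernelOf false
regime true true  false = kernelOf true
regime _    _     _     = nobody

candidates : QF → ℕ → ℕ → Candidates
candidates χ n k with n ≤? suc (k + k)
... | yes _ = everybody
... | no _  = regime (diagonal χ false) (offDiagonal χ true false false) (offDiagonal χ false false false)

coverSize : ℕ → ℕ
coverSize k = suc (k + k) + k * k

record SmallWitness {n} (χ : QF) (a : Adj n) (k : ℕ) (c : Candidates) : Set where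
  field
    witness            : Subset n
    witness-size       : ∣ witness ∣ ≤ k
    witness-satisfies  : Satisfies χ a witness
    witness-candidates : ∀ {x} → x ∈ₛ witness → Candidate c k a x
    cover              : List (Fin n)
    cover-size         : length cover ≤ coverSize k
    cover-candidates   : ∀ {x} → Candidate c k a x → x ∈ cover

module _ {n} {χ : QF} {a : Adj n} {k : ℕ} (basic : IsBasic a) {C : Subset n} (∣C∣≤k : ∣ C ∣ ≤ k)
         (sat : Satisfies χ a C) where

  private
    U : Bool → Bool
    U = diagonal χ
    R : Bool → Bool → Bool → Bool
    R = offDiagonal χ
    solves : Solves a U R C
    solves = to (satisfies⇔solves basic χ C) sat
    satisfies : ∀ {C′} → Solves a U R C′ → Satisfies χ a C′
    satisfies = from (satisfies⇔solves basic χ _)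

  emptyWitness : T (U false) → T (R true false false) → T (R false false false) → SmallWitness χ a k nobody
  emptyWitness U0 R100 R000 = record
    { witness = ∅ ; witness-size = ≤-trans (≤-reflexive (∣⊥∣≡0 n)) z≤n
    ; witness-satisfies = satisfies (diag , off) ; witness-candidates = ⊥-elim ∘ ∉⊥
    ; cover = [] ; cover-size = z≤n ; cover-candidates = λ () }
    where
    diag : ∀ x → T (U (lookup ∅ x))
    diag x = subst (T ∘ U) (sym (lookup-replicate x false)) U0
    off : ∀ x y → x ≢ y → T (R (a x y) (lookup ∅ x) (lookup ∅ y))
    off x y _ rewrite lookup-replicate {n = n} x false | lookup-replicate {n = n} y false with a x y
    ... | true  = R100
    ... | false = R000

  kernelWitness : ∀ b {R′} → IsBasic (graphFor b a) →
                  T (U false) → ¬ T (R′ true false false) → T (R′ false false false) → Solves (graphFor b a) U R′ C →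
                  (∀ {C′} → Solves (graphFor b a) U R′ C′ → Satisfies χ a C′) → k + k < n →
                  SmallWitness χ a k (kernelOf b)
  kernelWitness b {R′} basic′ U0 ¬R100 R000 solves′ back large = record
    { witness = C ∩ kernel ; witness-size = ≤-trans (∣p∩q∣≤∣p∣ C kernel) ∣C∣≤k
    ; witness-satisfies = back (kernel-solves basic′ {U} {R′} U0 ¬R100 R000 {C} solves′ ∣C∣≤k large)
    ; witness-candidates = to ∈-kernel ∘ proj₂ ∘ x∈p∩q⁻ C kernel
    ; cover = proj₁ cover′
    ; cover-size = ≤-trans (proj₁ (proj₂ cover′)) (+-monoˡ-≤ (k * k) (m≤n⇒m≤1+n (m≤m+n k k)))
    ; cover-candidates = proj₂ (proj₂ cover′) }
    where
    open Kernel k (graphFor b a)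
    cover′ = kernel-cover basic′ {U} {R′} U0 ¬R100 R000 {C} solves′ ∣C∣≤k

  module _ (large : suc (k + k) < n) where

    vertexOutside : ∃ λ y → y ∉ₛ C
    vertexOutside = let y , _ , y∉C = ∣q∣<∣p∣⇒∃∈p∉q {p = everything} {q = C} ∣C∣<∣everything∣ in y , y∉C
      where
      ∣C∣<∣everything∣ : ∣ C ∣ < ∣ everything {n} ∣
      ∣C∣<∣everything∣ = ≤-<-trans ∣C∣≤k
        (subst (k <_) (sym (∣⊤∣≡n n)) (≤-trans (s≤s (m≤m+n k k)) (≤-trans (n≤1+n _) large)))

    twoVerticesOutside : ∃ λ y → ∃ λ z → y ∉ₛ C × z ∉ₛ C × y ≢ z
    twoVerticesOutside =
      let y , y∉C = vertexOutside ; z , z∈∁C , z∉⁅y⁆ = ∣q∣<∣p∣⇒∃∈p∉q {p = ∁ C} {q = ⁅ y ⁆} (1<∣∁C∣ y)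
      in y , z , y∉C , x∈∁p⇒x∉p z∈∁C , x∉⁅y⁆⇒x≢y z∉⁅y⁆ ∘ sym
      where
      open ≤-Reasoning
      1<∣∁C∣ : ∀ y → ∣ ⁅ y ⁆ ∣ < ∣ ∁ C ∣
      1<∣∁C∣ y = begin-strict
        ∣ ⁅ y ⁆ ∣     ≡⟨ ∣⁅x⁆∣≡1 y ⟩
        1             <⟨ m+n≤o⇒m≤o∸n 2 (≤-trans (+-monoʳ-≤ 2 (m≤n+m k k)) large) ⟩
        n ∸ k         ≤⟨ ∸-monoʳ-≤ n ∣C∣≤k ⟩
        n ∸ ∣ C ∣     ≡⟨ ∣∁p∣≡n∸∣p∣ C ⟨
        ∣ ∁ C ∣       ∎

    regimeWitness : ∀ u r₁ r₀ → U false ≡ u → R true false false ≡ r₁ → R false false false ≡ r₀ →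
                    SmallWitness χ a k (regime u r₁ r₀)
    regimeWitness false _ _ U0≡ _ _ =
      let y , y∉C = vertexOutside in ⊥-elim (subst T U0≡ (subst (T ∘ U) (lookup-∉ y∉C) (proj₁ solves y)))
    regimeWitness true true true U0≡ R100≡ R000≡ =
      emptyWitness (from T-≡ U0≡) (from T-≡ R100≡) (from T-≡ R000≡)
    regimeWitness true false false _ R100≡ R000≡ with twoVerticesOutside
    ... | y , z , y∉C , z∉C , y≢z with a y z | proj₂ solves y z y≢z
    ...   | true  | holds = ⊥-elim (subst T R100≡ (subst₂ (λ p q → T (R true p q)) (lookup-∉ y∉C) (lookup-∉ z∉C) holds))
    ...   | false | holds = ⊥-elim (subst T R000≡ (subst₂ (λ p q → T (R false p q)) (lookup-∉ y∉C) (lookup-∉ z∉C) holds))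
    regimeWitness true false true U0≡ R100≡ R000≡ =
      kernelWitness false {R} basic (from T-≡ U0≡) (subst T R100≡) (from T-≡ R000≡) solves satisfies
        (≤-trans (n≤1+n _) large)
    regimeWitness true true false U0≡ R100≡ R000≡ =
      kernelWitness true {flipEdge R} (complement-basic basic) (from T-≡ U0≡) (subst T R000≡) (from T-≡ R100≡)
        (solves-complement {g = a} {U} {R} {C} solves)
        (λ {C′} → satisfies ∘ solves-complement⁻ {g = a} {U} {R} {C′})
        (≤-trans (n≤1+n _) large)

  smallWitness : SmallWitness χ a k (candidates χ n k)
  smallWitness with n ≤? suc (k + k)
  ... | yes small = record
    { witness = C ; witness-size = ∣C∣≤k ; witness-satisfies = sat ; witness-candidates = λ _ → tt
    ; cover = allFin n
    ; cover-size = ≤-trans (≤-reflexive (length-tabulate _)) (≤-trans small (m≤m+n _ (k * k)))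
    ; cover-candidates = λ _ → ∈-allFin _ }
  ... | no ¬small = regimeWitness (≰⇒> ¬small) _ _ _ refl refl refl

-- The circuit

module _ {n : ℕ} where

  edgeC : Bool → Fin n → Fin n → Circ (Input n) 1
  edgeC false u v = inp (u , v)
  edgeC true  u v = if ⌊ u ≟ v ⌋ then const false else neg (inp (u , v))

  highC : (Fin n → Fin n → Circ (Input n) 1) → ℕ → Fin n → Circ (Input n) 10
  highC edge k v = neg (AtMost.atMost k (edge v))

  lowNeighbourC : (Fin n → Fin n → Circ (Input n) 1) → ℕ → Fin n → Fin n → Circ (Input n) 12
  lowNeighbourC edge k v u = edge v u ∧ᶜ neg (highC edge k u)

  kernelC : (Fin n → Fin n → Circ (Input n) 1) → ℕ → Fin n → Circ (Input n) 14
  kernelC edge k v = highC edge k v ∨ᶜ ⋁ (allFin n) (lowNeighbourC edge k v)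

  candidateC : Candidates → ℕ → Fin n → Circ (Input n) 14
  candidateC nobody       k v = const false
  candidateC everybody    k v = const true
  candidateC (kernelOf b) k v = kernelC (edgeC b) k v

  arrowC : Fin n → Fin n → Circ (Input n) 2
  arrowC u v = neg (inp {d = 0} (u , v)) ∨ᶜ inp {d = 0} (v , u)

  loopC : Fin n → Circ (Input n) 1
  loopC u = neg (inp (u , u))

  symmetricC : Circ (Input n) 4
  symmetricC = ⋀ (allFin n) λ u → ⋀ (allFin n) (arrowC u)

  irreflexiveC : Circ (Input n) 2
  irreflexiveC = ⋀ (allFin n) loopC

  basicC : Circ (Input n) 5
  basicC = symmetricC ∧ᶜ irreflexiveC

  satisfiesC : ∀ χ → (Fin n → Circ (Input n) 15) → Circ (Input n) (2 + depth χ 15)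
  satisfiesC χ M = ⋀ (allFin n) λ x → ⋀ (allFin n) λ y → compile χ M (env x y)

  module _ (a : Adj n) where

    private
      ρ : Input n → Bool
      ρ = uncurryAdj a

    eval-edgeC : ∀ b u v → eval (edgeC b u v) ρ ≡ graphFor b a u v
    eval-edgeC false u v = refl
    eval-edgeC true  u v with u ≟ v
    ... | yes _ = refl
    ... | no _  = refl

    module _ (k : ℕ) (b : Bool) where

      open Kernel k (graphFor b a) using (High; InKernel)

      T-highC : ∀ v → T (eval (highC (edgeC b) k v) ρ) ⇔ High v
      T-highC v = mk⇔ (λ t → ≰⇒> (to T-not t ∘ from atMost⇔)) (λ high → from T-not (<⇒≱ high ∘ to atMost⇔))
        where
        atMost⇔ : T (eval (AtMost.atMost k (edgeC b v)) ρ) ⇔ ∣ neighbours (graphFor b a) v ∣ ≤ k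
        atMost⇔ = subst (λ p → T (eval (AtMost.atMost k (edgeC b v)) ρ) ⇔ ∣ p ∣ ≤ k)
                        (tabulate-cong (eval-edgeC b v)) (AtMost.T-atMost k (edgeC b v) ρ)

      T-lowNeighbourC : ∀ v u → T (eval (lowNeighbourC (edgeC b) k v u) ρ) ⇔ (T (graphFor b a v u) × ¬ High u)
      T-lowNeighbourC v u = subst (λ β → T β ⇔ (T (graphFor b a v u) × ¬ High u))
        (sym (eval-∧ᶜ ρ (edgeC b v u) (neg (highC (edgeC b) k u))))
        (mk⇔ (λ t → let e , h = to T-∧ t in subst T (eval-edgeC b v u) e , to T-not h ∘ from (T-highC u))
             (λ (e , ¬h) → from T-∧ (subst T (sym (eval-edgeC b v u)) e , from T-not (¬h ∘ to (T-highC u)))))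

      T-kernelC : ∀ v → T (eval (kernelC (edgeC b) k v) ρ) ⇔ InKernel v
      T-kernelC v = subst (λ β → T β ⇔ InKernel v) (sym (eval-∨ᶜ ρ (highC (edgeC b) k v) lowNeighbour))
        (mk⇔ (Sum.map (to (T-highC v)) lowNeighbour⇒ ∘ to T-∨) (from T-∨ ∘ Sum.map (from (T-highC v)) ⇒lowNeighbour))
        where
        lowNeighbour : Circ (Input n) 13
        lowNeighbour = ⋁ (allFin n) (lowNeighbourC (edgeC b) k v)
        lowNeighbour⇒ : T (eval lowNeighbour ρ) → ∃ λ u → T (graphFor b a v u) × ¬ High u
        lowNeighbour⇒ t = let u , _ , low = to (T-⋁ ρ (allFin n) _) t in u , to (T-lowNeighbourC v u) low
        ⇒lowNeighbour : (∃ λ u → T (graphFor b a v u) × ¬ High u) → T (eval lowNeighbour ρ)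
        ⇒lowNeighbour (u , low) = from (T-⋁ ρ (allFin n) _) (u , ∈-allFin u , from (T-lowNeighbourC v u) low)

    T-candidateC : ∀ k c v → T (eval (candidateC c k v) ρ) ⇔ Candidate c k a v
    T-candidateC k nobody       v = mk⇔ (λ ()) (λ ())
    T-candidateC k everybody    v = mk⇔ (λ _ → tt) (λ _ → tt)
    T-candidateC k (kernelOf b) v = T-kernelC k b v

    T-basicC : T (eval basicC ρ) ⇔ IsBasic a
    T-basicC = subst (λ β → T β ⇔ IsBasic a) (sym (eval-∧ᶜ ρ symmetricC irreflexiveC))
      (mk⇔ (λ t → let s , i = to T-∧ t in
                   (λ u v → T-⇔→≡ (mk⇔ (implies s u v) (implies s v u))) ,
                   (λ u → to T-not-≡ (to (T-⋀ ρ (allFin n) loopC) i (∈-allFin u))))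
           (λ (symmetric , irreflexive) → from T-∧
             ( from (T-⋀ ρ (allFin n) row) (λ {u} _ → from (T-⋀ ρ (allFin n) (arrowC u)) λ {v} _ →
                 from (T-arrowC u v) (subst T (symmetric u v)))
             , from (T-⋀ ρ (allFin n) loopC) (λ {u} _ → from T-not-≡ (irreflexive u)))))
      where
      row : Fin n → Circ (Input n) 3
      row u = ⋀ (allFin n) (arrowC u)
      T-arrowC : ∀ u v → T (eval (arrowC u v) ρ) ⇔ (T (a u v) → T (a v u))
      T-arrowC u v = subst (λ β → T β ⇔ (T (a u v) → T (a v u)))
                           (sym (eval-∨ᶜ ρ (neg (inp {d = 0} (u , v))) (inp {d = 0} (v , u)))) T-→
      implies : T (eval symmetricC ρ) → ∀ u v → T (a u v) → T (a v u)
      implies t u v = to (T-arrowC u v)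
        (to (T-⋀ ρ (allFin n) (arrowC u)) (to (T-⋀ ρ (allFin n) row) t (∈-allFin u)) (∈-allFin v))

    T-satisfiesC : ∀ χ M → T (eval (satisfiesC χ M) ρ) ⇔ Satisfies χ a (tabulate λ x → eval (M x) ρ)
    T-satisfiesC χ M = mk⇔
      (λ t x y → subst T (eval-cell x y)
        (to (T-⋀ ρ (allFin n) (cell x)) (to (T-⋀ ρ (allFin n) row) t (∈-allFin x)) (∈-allFin y)))
      (λ sat → from (T-⋀ ρ (allFin n) row) λ {x} _ → from (T-⋀ ρ (allFin n) (cell x)) λ {y} _ →
        subst T (sym (eval-cell x y)) (sat x y))
      where
      cell : Fin n → Fin n → Circ (Input n) (depth χ 15)
      cell x y = compile χ M (env x y)
      row : Fin n → Circ (Input n) (1 + depth χ 15)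
      row x = ⋀ (allFin n) (cell x)
      eval-cell : ∀ x y → eval (cell x y) ρ ≡ ⟦ χ ⟧ a (tabulate λ x → eval (M x) ρ) (env x y)
      eval-cell x y = eval-compile χ M (env x y) a _ (λ z → sym (lookup∘tabulate _ z))

b-high : ℕ → Bound
b-high k = 1+ (b-atMost k (2 , 0))

b-kernel : ℕ → Bound
b-kernel k = b-high k ⊕ ((1 , 1) ⊗ ((2 , 0) ⊕ 1+ (b-high k)))

b-basic : Bound
b-basic = ((1 , 1) ⊗ ((1 , 1) ⊗ ((2 , 0) ⊕ (1 , 0)))) ⊕ ((1 , 1) ⊗ (2 , 0))

b-satisfies : QF → ℕ → Bound
b-satisfies χ k = (1 , 1) ⊗ ((1 , 1) ⊗ (formulaSize χ * proj₁ (1+ (b-kernel k)) , proj₂ (b-kernel k)))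

module _ {n : ℕ} where
  open Size n

  size-edgeC : ∀ b (u v : Fin n) → size (edgeC b u v) ≼ (2 , 0)
  size-edgeC false u v = mk≼ (s≤s z≤n)
  size-edgeC true  u v with u ≟ v
  ... | yes _ = mk≼ (s≤s z≤n)
  ... | no _  = mk≼ (s≤s (s≤s z≤n))

  size-highC : ∀ b k (v : Fin n) → size (highC (edgeC b) k v) ≼ b-high k
  size-highC b k v =
    size-neg (AtMost.atMost k (edgeC b v)) (AtMost.size-atMost k (edgeC b v) (2 , 0) (size-edgeC b v))

  size-candidateC : ∀ c k (v : Fin n) → size (candidateC c k v) ≼ b-kernel k
  size-candidateC nobody       k v = ≼-one (s≤s z≤n)
  size-candidateC everybody    k v = ≼-one (s≤s z≤n)
  size-candidateC (kernelOf b) k v =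
    size-∨ᶜ (highC (edgeC b) k v) (⋁ (allFin n) (lowNeighbourC (edgeC b) k v)) (size-highC b k v)
      (size-⋁ (allFin n) _ length-allFin≼ λ {u} _ →
        size-∧ᶜ (edgeC b v u) (neg (highC (edgeC b) k u)) (size-edgeC b v u)
                (size-neg (highC (edgeC b) k u) (size-highC b k u)))

  size-basicC : size (basicC {n}) ≼ b-basic
  size-basicC = size-∧ᶜ (symmetricC {n}) (irreflexiveC {n})
    (size-⋀ (allFin n) (λ u → ⋀ (allFin n) (arrowC u)) length-allFin≼ λ {u} _ →
      size-⋀ (allFin n) (arrowC u) length-allFin≼ λ {v} _ →
        size-∨ᶜ (neg (inp {d = 0} (u , v))) (inp {d = 0} (v , u)) (size-neg (inp {d = 0} (u , v)) ≼-const) ≼-const)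
    (size-⋀ (allFin n) loopC length-allFin≼ λ {u} _ → size-neg (inp {d = 0} (u , u)) ≼-const)

circuitDepth : QF → ℕ
circuitDepth χ = suc (5 ⊔ (3 + (19 ⊔ (2 + depth χ 15))))

circuit : (χ : QF) (n k : ℕ) → Circ (Input n) (circuitDepth χ)
circuit χ n k = basicC ∧ᶜ Guess.guess k (coverSize k) (candidateC (candidates χ n k) k) (satisfiesC χ)

circuit-correct : ∀ χ n k (a : Adj n) → T (eval (circuit χ n k) (uncurryAdj a)) ⇔ InProblem χ a k
circuit-correct χ n k a = subst (λ β → T β ⇔ InProblem χ a k) (sym (eval-∧ᶜ ρ basicC guess)) (mk⇔ sound complete)
  where
  ρ : Input n → Bool
  ρ = uncurryAdj a
  open Guess k (coverSize k) (candidateC (candidates χ n k) k) (satisfiesC χ)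
  open Correctness ρ (Satisfies χ a) (T-satisfiesC a χ)
  sound : T (eval basicC ρ ∧ eval guess ρ) → InProblem χ a k
  sound t = let basic , found = to T-∧ t ; C , ∣C∣≤k , _ , sat = guess-sound found
            in to (T-basicC a) basic , C , ∣C∣≤k , sat
  complete : InProblem χ a k → T (eval basicC ρ ∧ eval guess ρ)
  complete (basic , C , ∣C∣≤k , sat) = from T-∧ (from (T-basicC a) basic ,
    guess-complete witness witness-size (from (T-candidateC a k _ _) ∘ witness-candidates) witness-satisfies
                   cover cover-size (cover-candidates ∘ to (T-candidateC a k _ _)))
    where open SmallWitness (smallWitness {χ = χ} basic {C} ∣C∣≤k sat)

b-circuit : QF → ℕ → Bound
b-circuit χ k = b-basic ⊕ b-guess k (coverSize k) (b-kernel k) (b-satisfies χ k)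

size-circuit : ∀ χ n k → Size._≼_ n (size (circuit χ n k)) (b-circuit χ k)
size-circuit χ n k = size-∧ᶜ basicC guess size-basicC
  (size-guess (b-kernel k) cand≼ (b-satisfies χ k) λ J Λ →
    size-⋀ (allFin n) _ length-allFin≼ λ {x} _ → size-⋀ (allFin n) _ length-allFin≼ λ {y} _ →
      size-compile (s≤s z≤n) χ (member J Λ) (env x y) (size-member (b-kernel k) cand≼ J Λ))
  where
  open Size n
  open Guess k (coverSize k) (candidateC (candidates χ n k) k) (satisfiesC χ)
  cand≼ : ∀ v → size (candidateC (candidates χ n k) k v) ≼ b-kernel k
  cand≼ = size-candidateC (candidates χ n k) k

-- The exponent proj₂ (b-circuit χ k) reduces to a term free of k.
mainTheorem13 : (χ : QF) → InParaAC0 (λ a k → InProblem χ a k)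
mainTheorem13 χ =
  circuitDepth χ , proj₂ (b-circuit χ 0) , (λ k → proj₁ (b-circuit χ k)) , circuit χ ,
  (λ n k → Size.≤-bound (size-circuit χ n k)) ,
  (λ n k a → to (circuit-correct χ n k a) , from (circuit-correct χ n k a))
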